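{- Let $t\ge 4$ be a real number, let $G$ be a $t$-tough $(P_{3}\cup 3P_{1})$-free graph, and let $S$ be a cutset of $G$. Then $G$ has a generalized $K_{1,2}$-matching centered at the components of $G-S$.
   Context: All graphs are finite and simple. A cutset of $G$ is a set $S\subseteq V(G)$ with $G-S$ disconnected; $w(G-S)$ is the number of components of $G-S$. $G$ is $t$-tough if $|S|\ge t\cdot w(G-S)$ for every cutset $S$. $R$-free means no induced copy of $R$; $P_{3}\cup 3P_{1}$ is the disjoint union of a path on three vertices and three isolated vertices. For $X\subseteq V(G)$, $N_G(X)$ is the set of vertices outside $X$ adjacent to some vertex of $X$. For a nonempty $X\subseteq V(G)$ and $Y\subseteq N_G(X)$, $G[X,Y]$ is a generalized $K_{1,2}$ with center $X$ if $|Y|=2$ and, when $|X|\ge 2$, there exist partitions $\{X_1,X_2\}$ of $X$ and $\{Y_1,Y_2\}$ of $Y$ with $Y_i\subseteq N_G(X_i)\cap Y$ and $|Y_i|=1$ for $i=1,2$. If $S$ is a cutset and $D_1,\dots,D_\ell$ are the components of $G-S$, then $G$ has a generalized $K_{1,2}$-matching centered at the components of $G-S$ if for every $i$ there is $S_i\subseteq N_G(D_i)\cap S$ such that $G[V(D_i),S_i]$ is a generalized $K_{1,2}$ with center $V(D_i)$, and the sets $S_i$ are pairwise disjoint.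
   Formalization: The toughness parameter t ranges over the rationals with t ≥ 4, instead of over the reals. -}

module Defs where

open import Data.Nat using (ℕ; zero; suc; _≤_)
open import Data.Bool using (Bool; true; false; not; _∧_; _∨_)
open import Data.Fin using (Fin; zero; suc)
open import Data.Fin.Subset using (Subset; _∈_; _∉_; _⊆_; _∪_; _∩_; ⊥; ∣_∣; Nonempty)
open import Data.Vec using (Vec; lookup; tabulate)
open import Data.Product using (Σ; ∃; _×_; _,_)
open import Data.Empty using () renaming (⊥ to Empty)
open import Data.Integer using (+_)
open import Data.Rational using (ℚ; _/_)
open import Function.Definitions using (Injective)
open import Relation.Binary.PropositionalEquality using (_≡_; _≢_)
open import Relation.Nullary using (¬_)

record Graph (n : ℕ) : Set where
  field
    adj    : Fin n → Fin n → Bool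
    sym    : ∀ u v → adj u v ≡ adj v u
    irrefl : ∀ v → adj v v ≡ false
open Graph public

ℕtoℚ : ℕ → ℚ
ℕtoℚ k = (+ k) / 1

anyFin : ∀ {n} → (Fin n → Bool) → Bool
anyFin {zero}  f = false
anyFin {suc n} f = f zero ∨ anyFin (λ i → f (suc i))

Nbr : ∀ {n} → Graph n → Subset n → Subset n
Nbr G X = tabulate (λ v → not (lookup X v) ∧ anyFin (λ u → lookup X u ∧ adj G u v))

-- Reachability in G - S (walks using only vertices outside S)
data Reach {n} (G : Graph n) (S : Subset n) : Fin n → Fin n → Set where
  here : ∀ {u} → u ∉ S → Reach G S u u
  step : ∀ {u v w} → Reach G S u v → adj G v w ≡ true → w ∉ S → Reach G S u w

Cutset : ∀ {n} → Graph n → Subset n → Set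
Cutset G S = ∃ λ u → ∃ λ v → u ∉ S × v ∉ S × ¬ Reach G S u v

Component : ∀ {n} → Graph n → Subset n → Subset n → Set
Component G S C =
  Nonempty C
  × (∀ v → v ∈ C → v ∉ S)
  × (∀ u v → u ∈ C → v ∈ C → Reach G S u v)
  × (∀ u v → u ∈ C → Reach G S u v → v ∈ C)

NumComponents : ∀ {n} → Graph n → Subset n → ℕ → Set
NumComponents {n} G S k =
  Σ (Fin k → Subset n) λ cs →
    Injective _≡_ _≡_ cs
    × (∀ i → Component G S (cs i))
    × (∀ C → Component G S C → ∃ λ i → cs i ≡ C)

Tough : ∀ {n} → ℚ → Graph n → Set
Tough t G = ∀ S k → Cutset G S → NumComponents G S k →
  Data.Rational._≤_ (Data.Rational._*_ t (ℕtoℚ k)) (ℕtoℚ ∣ S ∣)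

-- the pattern graph P3 ∪ 3P1 on Fin 6: path 0-1-2, vertices 3,4,5 isolated
P3∪3P1 : Fin 6 → Fin 6 → Bool
P3∪3P1 zero (suc zero) = true
P3∪3P1 (suc zero) zero = true
P3∪3P1 (suc zero) (suc (suc zero)) = true
P3∪3P1 (suc (suc zero)) (suc zero) = true
P3∪3P1 _ _ = false

P3∪3P1-free : ∀ {n} → Graph n → Set
P3∪3P1-free {n} G =
  ¬ (Σ (Fin 6 → Fin n) λ f → Injective _≡_ _≡_ f × (∀ i j → adj G (f i) (f j) ≡ P3∪3P1 i j))

IsPartition2 : ∀ {n} → Subset n → Subset n → Subset n → Set
IsPartition2 X A B = Nonempty A × Nonempty B × (A ∩ B ≡ ⊥) × (A ∪ B ≡ X)

GenK12 : ∀ {n} → Graph n → Subset n → Subset n → Set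
GenK12 G X Y =
  Nonempty X
  × Y ⊆ Nbr G X
  × ∣ Y ∣ ≡ 2
  × (2 ≤ ∣ X ∣ →
      ∃ λ X₁ → ∃ λ X₂ → ∃ λ Y₁ → ∃ λ Y₂ →
        IsPartition2 X X₁ X₂ × IsPartition2 Y Y₁ Y₂
        × Y₁ ⊆ (Nbr G X₁ ∩ Y) × Y₂ ⊆ (Nbr G X₂ ∩ Y)
        × ∣ Y₁ ∣ ≡ 1 × ∣ Y₂ ∣ ≡ 1)

GenK12Matching : ∀ {n} → Graph n → Subset n → Set
GenK12Matching {n} G S =
  Σ ((C : Subset n) → Component G S C → Subset n) λ σ →
    (∀ C (c : Component G S C) → σ C c ⊆ (Nbr G C ∩ S) × GenK12 G C (σ C c))
    × (∀ C C' (c : Component G S C) (c' : Component G S C') →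
         C ≢ C' → σ C c ∩ σ C' c' ≡ ⊥)

module Submission where

-- The generalized K_{1,2}'s are read off from a matching, given by Hall's theorem, in an
-- auxiliary bipartite graph.  Its left side has a copy of every vertex of G - S and a
-- second copy (the twin) of every vertex forming a one-vertex component; its right side
-- has S and the dummies, which are all vertices of a nontrivial component except two
-- chosen ones.  A left copy of x is joined to the neighbours of x in S, and an original
-- copy also to the dummies of its component.  Every component has exactly two more left
-- vertices than dummies, so a matching sends two of them into S, at distinct vertices,
-- and from distinct vertices when the component is nontrivial.
--
-- For Hall's condition at a set X of left vertices, call a component almost covered if X
-- misses at most one of its left vertices.  Removing the S-neighbours of X together with
-- the missed vertices separates the almost covered components, so 4-toughness gives
-- 2 · #(almost covered) ≤ #(S-neighbours of X), which pays for the two left vertices per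
-- component not covered by dummies.

open import Data.Bool using (Bool; true; false; not; _∧_; if_then_else_)
import Data.Bool.Properties as BoolP
open import Data.Empty using (⊥-elim)
open import Data.Fin as Fin using (Fin; zero; suc; _↑ˡ_; _↑ʳ_)
import Data.Fin.Properties as FinP
open import Data.Fin.Subset
open import Data.Fin.Subset.Properties
import Data.Integer as ℤ
import Data.Integer.Properties as ℤP
open import Data.Nat as ℕ using (ℕ; zero; suc; _+_; _*_; _≤_; z≤n; s≤s)
open import Data.Nat.Coprimality using (gcd≡1⇒coprime)
open import Data.Nat.GCD using (gcd-zeroʳ)
open import Data.Nat.GeneralisedArithmetic using (fold)
import Data.Nat.Properties as ℕP
open import Algebra.Properties.Semiring.Sum ℕP.+-*-semiring
  using (sum-syntax; ∑-distrib-+; *-distribˡ-sum; sum-replicate-zero)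
open import Data.Product using (Σ; ∃; ∃₂; _×_; _,_; proj₁; proj₂)
open import Data.Rational as ℚ using (ℚ; toℚᵘ)
import Data.Rational.Properties as ℚP
import Data.Rational.Unnormalised as ℚᵘ
import Data.Rational.Unnormalised.Properties as ℚᵘP
open import Data.Sum using (_⊎_; inj₁; inj₂; [_,_]′)
open import Data.Vec using ([]; _∷_; here; there; lookup; tabulate; _++_)
open import Data.Vec.Properties using ([]=⇒lookup; lookup⇒[]=; lookup∘tabulate)
import Data.Vec.Properties as VecP
open import Function using (_∘_; id; case_of_)
open import Relation.Binary.PropositionalEquality
open import Relation.Nullary using (¬_; Dec; yes; no; does; _×-dec_; _⊎-dec_; ¬?)
open import Relation.Nullary.Decidable using (dec-true)
open import Relation.Unary using (Pred; Decidable)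
open import Defs hiding (sym)

module _ {n p} {P : Pred (Fin n) p} (P? : Decidable P) where

  select : Subset n
  select = tabulate (does ∘ P?)

  ∈-select⁺ : ∀ {x} → P x → x ∈ select
  ∈-select⁺ {x} Px = lookup⇒[]= x select (trans (lookup∘tabulate (does ∘ P?) x) (dec-true (P? x) Px))

  ∈-select⁻ : ∀ {x} → x ∈ select → P x
  ∈-select⁻ {x} x∈ = witness (P? x) (trans (sym (lookup∘tabulate (does ∘ P?) x)) ([]=⇒lookup x∈))
    where
    witness : (d : Dec (P x)) → does d ≡ true → P x
    witness (yes Px) _ = Px

∣p∪q∣+∣p∩q∣≡∣p∣+∣q∣ : ∀ {n} (p q : Subset n) → ∣ p ∪ q ∣ + ∣ p ∩ q ∣ ≡ ∣ p ∣ + ∣ q ∣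
∣p∪q∣+∣p∩q∣≡∣p∣+∣q∣ [] [] = refl
∣p∪q∣+∣p∩q∣≡∣p∣+∣q∣ (true ∷ p) (true ∷ q) =
  cong suc (trans (ℕP.+-suc _ _) (trans (cong suc (∣p∪q∣+∣p∩q∣≡∣p∣+∣q∣ p q)) (sym (ℕP.+-suc _ _))))
∣p∪q∣+∣p∩q∣≡∣p∣+∣q∣ (true ∷ p) (false ∷ q) = cong suc (∣p∪q∣+∣p∩q∣≡∣p∣+∣q∣ p q)
∣p∪q∣+∣p∩q∣≡∣p∣+∣q∣ (false ∷ p) (true ∷ q) =
  trans (cong suc (∣p∪q∣+∣p∩q∣≡∣p∣+∣q∣ p q)) (sym (ℕP.+-suc _ _))
∣p∪q∣+∣p∩q∣≡∣p∣+∣q∣ (false ∷ p) (false ∷ q) = ∣p∪q∣+∣p∩q∣≡∣p∣+∣q∣ p q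

∣p∪q∣≤∣p∣+∣q∣ : ∀ {n} (p q : Subset n) → ∣ p ∪ q ∣ ≤ ∣ p ∣ + ∣ q ∣
∣p∪q∣≤∣p∣+∣q∣ p q = ℕP.≤-trans (ℕP.m≤m+n _ _) (ℕP.≤-reflexive (∣p∪q∣+∣p∩q∣≡∣p∣+∣q∣ p q))

Empty⇒∣p∣≡0 : ∀ {n} {p : Subset n} → Empty p → ∣ p ∣ ≡ 0
Empty⇒∣p∣≡0 {n} e rewrite Empty-unique e = ∣⊥∣≡0 n

∣p∪q∣≡∣p∣+∣q∣ : ∀ {n} {p q : Subset n} → Empty (p ∩ q) → ∣ p ∪ q ∣ ≡ ∣ p ∣ + ∣ q ∣
∣p∪q∣≡∣p∣+∣q∣ {p = p} {q} disjoint = begin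
  ∣ p ∪ q ∣                  ≡⟨ sym (ℕP.+-identityʳ _) ⟩
  ∣ p ∪ q ∣ + 0              ≡⟨ cong (∣ p ∪ q ∣ +_) (sym (Empty⇒∣p∣≡0 disjoint)) ⟩
  ∣ p ∪ q ∣ + ∣ p ∩ q ∣      ≡⟨ ∣p∪q∣+∣p∩q∣≡∣p∣+∣q∣ p q ⟩
  ∣ p ∣ + ∣ q ∣              ∎
  where open ≡-Reasoning

p⊆q∪p─q : ∀ {n} (p q : Subset n) → p ⊆ q ∪ (p ─ q)
p⊆q∪p─q p q {x} x∈p with x ∈? q
... | yes x∈q = x∈p∪q⁺ (inj₁ x∈q)
... | no x∉q = x∈p∪q⁺ (inj₂ (x∈p∧x∉q⇒x∈p─q x∈p x∉q))

∣p∩q∣+∣p─q∣≡∣p∣ : ∀ {n} (p q : Subset n) → ∣ p ∩ q ∣ + ∣ p ─ q ∣ ≡ ∣ p ∣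
∣p∩q∣+∣p─q∣≡∣p∣ [] [] = refl
∣p∩q∣+∣p─q∣≡∣p∣ (true ∷ p) (true ∷ q) = cong suc (∣p∩q∣+∣p─q∣≡∣p∣ p q)
∣p∩q∣+∣p─q∣≡∣p∣ (true ∷ p) (false ∷ q) = trans (ℕP.+-suc _ _) (cong suc (∣p∩q∣+∣p─q∣≡∣p∣ p q))
∣p∩q∣+∣p─q∣≡∣p∣ (false ∷ p) (true ∷ q) = ∣p∩q∣+∣p─q∣≡∣p∣ p q
∣p∩q∣+∣p─q∣≡∣p∣ (false ∷ p) (false ∷ q) = ∣p∩q∣+∣p─q∣≡∣p∣ p q

x∈p─q⁻ : ∀ {n} (p q : Subset n) {x} → x ∈ p ─ q → x ∈ p × x ∉ q
x∈p─q⁻ (true ∷ p) (false ∷ q) here = here , λ ()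
x∈p─q⁻ (true ∷ p) (true ∷ q) {zero} ()
x∈p─q⁻ (false ∷ p) (true ∷ q) {zero} ()
x∈p─q⁻ (false ∷ p) (false ∷ q) {zero} ()
x∈p─q⁻ (_ ∷ p) (_ ∷ q) (there x∈) with x∈p─q⁻ p q x∈
... | x∈p , x∉q = there x∈p , λ { (there x∈q) → x∉q x∈q }

⊆∧≢⇒⊂ : ∀ {n} {p q : Subset n} → p ⊆ q → p ≢ q → p ⊂ q
⊆∧≢⇒⊂ {p = p} {q} p⊆q p≢q with FinP.any? (λ x → x ∈? q ×-dec ¬? (x ∈? p))
... | yes witness = p⊆q , witness
... | no none = ⊥-elim (p≢q (⊆-antisym p⊆q q⊆p))
  where
  q⊆p : q ⊆ p
  q⊆p {x} x∈q with x ∈? p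
  ... | yes x∈p = x∈p
  ... | no x∉p = ⊥-elim (none (x , x∈q , x∉p))

∣p++q∣≡∣p∣+∣q∣ : ∀ {m n} (p : Subset m) (q : Subset n) → ∣ p ++ q ∣ ≡ ∣ p ∣ + ∣ q ∣
∣p++q∣≡∣p∣+∣q∣ [] q = refl
∣p++q∣≡∣p∣+∣q∣ (true ∷ p) q = cong suc (∣p++q∣≡∣p∣+∣q∣ p q)
∣p++q∣≡∣p∣+∣q∣ (false ∷ p) q = ∣p++q∣≡∣p∣+∣q∣ p q

1≤∣p∣⇒Nonempty : ∀ {n} (p : Subset n) → 1 ≤ ∣ p ∣ → Nonempty p
1≤∣p∣⇒Nonempty p 1≤∣p∣ with nonempty? p
... | yes ne = ne
... | no ¬ne with () ← ℕP.≤-trans 1≤∣p∣ (ℕP.≤-reflexive (Empty⇒∣p∣≡0 ¬ne))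

∈-++⁺ˡ : ∀ {m n} {p : Subset m} {q : Subset n} {x} → x ∈ p → x ↑ˡ n ∈ p ++ q
∈-++⁺ˡ here = here
∈-++⁺ˡ (there x∈) = there (∈-++⁺ˡ x∈)

∈-++⁻ˡ : ∀ {m n} (p : Subset m) {q : Subset n} {x} → x ↑ˡ n ∈ p ++ q → x ∈ p
∈-++⁻ˡ (true ∷ p) {x = zero} _ = here
∈-++⁻ˡ (_ ∷ p) {x = suc x} (there x∈) = there (∈-++⁻ˡ p x∈)

∈-++⁺ʳ : ∀ {m n} (p : Subset m) {q : Subset n} {y} → y ∈ q → m ↑ʳ y ∈ p ++ q
∈-++⁺ʳ [] y∈ = y∈
∈-++⁺ʳ (_ ∷ p) y∈ = there (∈-++⁺ʳ p y∈)

∈-++⁻ʳ : ∀ {m n} (p : Subset m) {q : Subset n} {y} → m ↑ʳ y ∈ p ++ q → y ∈ q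
∈-++⁻ʳ [] y∈ = y∈
∈-++⁻ʳ (_ ∷ p) (there y∈) = ∈-++⁻ʳ p y∈

enumerate : ∀ {n} (p : Subset n) → Fin ∣ p ∣ → Fin n
enumerate (true ∷ p) zero = zero
enumerate (true ∷ p) (suc i) = suc (enumerate p i)
enumerate (false ∷ p) i = suc (enumerate p i)

enumerate∈ : ∀ {n} (p : Subset n) i → enumerate p i ∈ p
enumerate∈ (true ∷ p) zero = here
enumerate∈ (true ∷ p) (suc i) = there (enumerate∈ p i)
enumerate∈ (false ∷ p) i = there (enumerate∈ p i)

index : ∀ {n} (p : Subset n) {x} → x ∈ p → Fin ∣ p ∣
index (true ∷ p) here = zero
index (true ∷ p) (there x∈) = suc (index p x∈)
index (false ∷ p) (there x∈) = index p x∈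

enumerate∘index : ∀ {n} (p : Subset n) {x} (x∈ : x ∈ p) → enumerate p (index p x∈) ≡ x
enumerate∘index (true ∷ p) here = refl
enumerate∘index (true ∷ p) (there x∈) = cong suc (enumerate∘index p x∈)
enumerate∘index (false ∷ p) (there x∈) = cong suc (enumerate∘index p x∈)

index-injective : ∀ {n} (p : Subset n) {x y} (x∈ : x ∈ p) (y∈ : y ∈ p) →
                  index p x∈ ≡ index p y∈ → x ≡ y
index-injective p x∈ y∈ eq =
  trans (sym (enumerate∘index p x∈)) (trans (cong (enumerate p) eq) (enumerate∘index p y∈))

∈-irrelevant : ∀ {n} {p : Subset n} {x} (a b : x ∈ p) → a ≡ b
∈-irrelevant here here = refl
∈-irrelevant (there a) (there b) = cong there (∈-irrelevant a b)

index∘enumerate : ∀ {n} (p : Subset n) i → index p (enumerate∈ p i) ≡ i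
index∘enumerate (true ∷ p) zero = refl
index∘enumerate (true ∷ p) (suc i) = cong suc (index∘enumerate p i)
index∘enumerate (false ∷ p) i = index∘enumerate p i

enumerate-injective : ∀ {n} (p : Subset n) {i j} → enumerate p i ≡ enumerate p j → i ≡ j
enumerate-injective p {i} {j} eq = begin
  i                                                   ≡⟨ sym (index∘enumerate p i) ⟩
  index p (enumerate∈ p i)                            ≡⟨ index-cong eq ⟩
  index p (enumerate∈ p j)                            ≡⟨ index∘enumerate p j ⟩
  j                                                   ∎
  where
  open ≡-Reasoning
  index-cong : ∀ {x y} {x∈ : x ∈ p} {y∈ : y ∈ p} → x ≡ y → index p x∈ ≡ index p y∈
  index-cong {x∈ = x∈} {y∈} refl = cong (index p) (∈-irrelevant x∈ y∈)

InjectiveOn : ∀ {m} {B : Set} → Subset m → (Fin m → B) → Set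
InjectiveOn p f = ∀ {x y} → x ∈ p → y ∈ p → f x ≡ f y → x ≡ y

injectiveOn⇒∣p∣≤∣q∣ : ∀ {m n} {p : Subset m} {q : Subset n} (f : Fin m → Fin n) →
                      (∀ {x} → x ∈ p → f x ∈ q) → InjectiveOn p f → ∣ p ∣ ≤ ∣ q ∣
injectiveOn⇒∣p∣≤∣q∣ {p = p} {q} f f∈ f-inj = FinP.injective⇒≤ {f = g} g-injective
  where
  g : Fin ∣ p ∣ → Fin ∣ q ∣
  g i = index q (f∈ (enumerate∈ p i))
  g-injective : ∀ {i j} → g i ≡ g j → i ≡ j
  g-injective eq = enumerate-injective p
    (f-inj (enumerate∈ p _) (enumerate∈ p _) (index-injective q _ _ eq))

⁅x⁆∩⁅y⁆≡⊥ : ∀ {n} {x y : Fin n} → x ≢ y → ⁅ x ⁆ ∩ ⁅ y ⁆ ≡ ⊥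
⁅x⁆∩⁅y⁆≡⊥ {x = x} {y} x≢y = Empty-unique λ (z , z∈) →
  let z∈x , z∈y = x∈p∩q⁻ ⁅ x ⁆ ⁅ y ⁆ z∈ in
  x≢y (trans (sym (x∈⁅y⁆⇒x≡y x z∈x)) (x∈⁅y⁆⇒x≡y y z∈y))

x≡y⇒x∈⁅y⁆ : ∀ {n} {x y : Fin n} → x ≡ y → x ∈ ⁅ y ⁆
x≡y⇒x∈⁅y⁆ refl = x∈⁅x⁆ _

∣⁅x⁆∪⁅y⁆∣≡2 : ∀ {n} {x y : Fin n} → x ≢ y → ∣ ⁅ x ⁆ ∪ ⁅ y ⁆ ∣ ≡ 2
∣⁅x⁆∪⁅y⁆∣≡2 {x = x} {y} x≢y = trans (∣p∪q∣≡∣p∣+∣q∣ disjoint) (cong₂ _+_ (∣⁅x⁆∣≡1 x) (∣⁅x⁆∣≡1 y))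
  where
  disjoint : Empty (⁅ x ⁆ ∩ ⁅ y ⁆)
  disjoint (z , z∈) = ∉⊥ (subst (z ∈_) (⁅x⁆∩⁅y⁆≡⊥ x≢y) z∈)

two-members⇒2≤∣p∣ : ∀ {n} {p : Subset n} {x y} → x ∈ p → y ∈ p → x ≢ y → 2 ≤ ∣ p ∣
two-members⇒2≤∣p∣ {p = p} {x} {y} x∈ y∈ x≢y =
  subst (_≤ ∣ p ∣) (∣⁅x⁆∪⁅y⁆∣≡2 x≢y) (p⊆q⇒∣p∣≤∣q∣ pair⊆p)
  where
  pair⊆p : ⁅ x ⁆ ∪ ⁅ y ⁆ ⊆ p
  pair⊆p z∈ with x∈p∪q⁻ ⁅ x ⁆ ⁅ y ⁆ z∈
  ... | inj₁ z∈x = subst (_∈ p) (sym (x∈⁅y⁆⇒x≡y x z∈x)) x∈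
  ... | inj₂ z∈y = subst (_∈ p) (sym (x∈⁅y⁆⇒x≡y y z∈y)) y∈

∣p∣≤1⇒x≡y : ∀ {n} {p : Subset n} {x y} → ∣ p ∣ ≤ 1 → x ∈ p → y ∈ p → x ≡ y
∣p∣≤1⇒x≡y {x = x} {y} ∣p∣≤1 x∈ y∈ with x Fin.≟ y
... | yes x≡y = x≡y
... | no x≢y = ⊥-elim (ℕP.1+n≰n (ℕP.≤-trans (s≤s ∣p∣≤1) (two-members⇒2≤∣p∣ x∈ y∈ x≢y)))

2≤∣p∣⇒two-members : ∀ {n} (p : Subset n) → 2 ≤ ∣ p ∣ → ∃₂ λ x y → x ∈ p × y ∈ p × x ≢ y
2≤∣p∣⇒two-members p 2≤∣p∣ =
  enumerate p first , enumerate p second , enumerate∈ p first , enumerate∈ p second ,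
  λ eq → ℕP.0≢1+n (trans (sym (FinP.toℕ-fromℕ< _))
                  (trans (cong Fin.toℕ (enumerate-injective p eq)) (FinP.toℕ-fromℕ< _)))
  where
  first second : Fin ∣ p ∣
  first = Fin.fromℕ< (ℕP.≤-trans (s≤s z≤n) 2≤∣p∣)
  second = Fin.fromℕ< 2≤∣p∣

2≤∣p∣⇒Nonempty[p-x] : ∀ {n} {p : Subset n} x → 2 ≤ ∣ p ∣ → Nonempty (p - x)
2≤∣p∣⇒Nonempty[p-x] {p = p} x 2≤∣p∣ with 2≤∣p∣⇒two-members p 2≤∣p∣
... | y , z , y∈ , z∈ , y≢z with y Fin.≟ x
...   | yes refl = z , x∈p∧x≢y⇒x∈p-y z∈ (y≢z ∘ sym)
...   | no y≢x = y , x∈p∧x≢y⇒x∈p-y y∈ y≢x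

choice : ∀ {n} → Fin n → Subset n → Fin n
choice d p with nonempty? p
... | yes (x , _) = x
... | no _ = d

choice∈ : ∀ {n} d {p : Subset n} → Nonempty p → choice d p ∈ p
choice∈ d {p} ne with nonempty? p
... | yes (_ , x∈) = x∈
... | no empty = ⊥-elim (empty ne)

choice-default-irrelevant : ∀ {n} d d′ {p : Subset n} → Nonempty p → choice d p ≡ choice d′ p
choice-default-irrelevant d d′ {p} ne with nonempty? p
... | yes _ = refl
... | no empty = ⊥-elim (empty ne)

fibre : ∀ {m k} → (Fin m → Fin k) → Fin k → Subset m
fibre f r = select (λ x → f x Fin.≟ r)

∈fibre⁺ : ∀ {m k} {f : Fin m → Fin k} {r x} → f x ≡ r → x ∈ fibre f r
∈fibre⁺ {f = f} {r} = ∈-select⁺ (λ x → f x Fin.≟ r)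

∈fibre⁻ : ∀ {m k} {f : Fin m → Fin k} {r x} → x ∈ fibre f r → f x ≡ r
∈fibre⁻ {f = f} {r} = ∈-select⁻ (λ x → f x Fin.≟ r)

∑-mono-≤ : ∀ {k} {f g : Fin k → ℕ} → (∀ i → f i ≤ g i) → ∑[ i < k ] f i ≤ ∑[ i < k ] g i
∑-mono-≤ {zero} f≤g = z≤n
∑-mono-≤ {suc k} f≤g = ℕP.+-mono-≤ (f≤g zero) (∑-mono-≤ (f≤g ∘ suc))

∣p∣≡∑∣p∩fibre∣ : ∀ {m k} (f : Fin m → Fin k) (p : Subset m) →
                 ∣ p ∣ ≡ ∑[ r < k ] ∣ p ∩ fibre f r ∣
∣p∣≡∑∣p∩fibre∣ {k = k} f [] = sym (sum-replicate-zero k)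
∣p∣≡∑∣p∩fibre∣ f (false ∷ p) = ∣p∣≡∑∣p∩fibre∣ (f ∘ suc) p
∣p∣≡∑∣p∩fibre∣ f (true ∷ p) =
  trans (cong suc (∣p∣≡∑∣p∩fibre∣ (f ∘ suc) p)) (sym (∑-one-more (f zero) (λ r → p ∩ fibre (f ∘ suc) r)))
  where
  ∑-one-more : ∀ {k n} (c : Fin k) (q : Fin k → Subset n) →
               ∑[ r < k ] ∣ does (c Fin.≟ r) ∷ q r ∣ ≡ suc (∑[ r < k ] ∣ q r ∣)
  ∑-one-more zero q = refl
  ∑-one-more (suc c) q = trans (cong (∣ q zero ∣ +_) (∑-one-more c (q ∘ suc))) (ℕP.+-suc _ _)

-- Hall's theorem

module _ {m r : ℕ} where

  Neighbours : (Fin m → Subset r) → Subset m → Subset r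
  Neighbours E X = select (λ j → FinP.any? (λ x → x ∈? X ×-dec j ∈? E x))

  ∈-Neighbours⁺ : ∀ {E X x j} → x ∈ X → j ∈ E x → j ∈ Neighbours E X
  ∈-Neighbours⁺ {E} {X} x∈ j∈ = ∈-select⁺ (λ j → FinP.any? (λ x → x ∈? X ×-dec j ∈? E x)) (_ , x∈ , j∈)

  ∈-Neighbours⁻ : ∀ {E X j} → j ∈ Neighbours E X → ∃ λ x → x ∈ X × j ∈ E x
  ∈-Neighbours⁻ {E} {X} = ∈-select⁻ (λ j → FinP.any? (λ x → x ∈? X ×-dec j ∈? E x))

  HallCondition : (Fin m → Subset r) → Subset m → Set
  HallCondition E A = ∀ X → X ⊆ A → ∣ X ∣ ≤ ∣ Neighbours E X ∣

  Matching : (Fin m → Subset r) → Subset m → Set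
  Matching E A = Σ (Fin m → Fin r) λ f → (∀ {x} → x ∈ A → f x ∈ E x) × InjectiveOn A f

  _⊖_ : (Fin m → Subset r) → Subset r → Fin m → Subset r
  (E ⊖ Y) x = E x ─ Y

  Tight : (Fin m → Subset r) → Subset m → Subset m → Set
  Tight E A X = X ⊆ A × Nonempty X × Nonempty (A ─ X) × ∣ X ∣ ≡ ∣ Neighbours E X ∣

  tight? : ∀ E A → Decidable (Tight E A)
  tight? E A X = X ⊆? A ×-dec nonempty? X ×-dec nonempty? (A ─ X) ×-dec ∣ X ∣ ℕ.≟ ∣ Neighbours E X ∣

  Neighbours-⊖ : ∀ {E X Z Y} → (∀ {x} → x ∈ X → x ∉ Z → E x ⊆ Y) →
                 Neighbours E X ⊆ Neighbours (E ⊖ Y) Z ∪ Y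
  Neighbours-⊖ {E} {X} {Z} {Y} E⊆Y {j} j∈ with ∈-Neighbours⁻ j∈ | j ∈? Y
  ... | _ | yes j∈Y = x∈p∪q⁺ (inj₂ j∈Y)
  ... | x , x∈X , j∈Ex | no j∉Y with x ∈? Z
  ...   | yes x∈Z = x∈p∪q⁺ (inj₁ (∈-Neighbours⁺ x∈Z (x∈p∧x∉q⇒x∈p─q j∈Ex j∉Y)))
  ...   | no x∉Z = ⊥-elim (j∉Y (E⊆Y x∈X x∉Z j∈Ex))

  Matching-⊆ : ∀ {E A B} → A ⊆ B → Matching E B → Matching E A
  Matching-⊆ A⊆B (f , f∈E , f-inj) = f , f∈E ∘ A⊆B , λ x∈ y∈ → f-inj (A⊆B x∈) (A⊆B y∈)

  -- The combined map is injective because f₁ lands in Y while f₂ avoids it.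
  Matching-∪ : ∀ {E A₁ A₂ Y} → ((f₁ , _) : Matching E A₁) → (∀ {x} → x ∈ A₁ → f₁ x ∈ Y) →
               Matching (E ⊖ Y) A₂ → Matching E (A₁ ∪ A₂)
  Matching-∪ {E} {A₁} {A₂} {Y} (f₁ , f₁∈E , f₁-inj) f₁∈Y (f₂ , f₂∈E , f₂-inj) = f , f∈E , f-inj
    where
    f : Fin m → Fin r
    f x = if does (x ∈? A₁) then f₁ x else f₂ x
    from-A₂ : ∀ {x} → x ∈ A₁ ∪ A₂ → x ∉ A₁ → x ∈ A₂
    from-A₂ x∈ x∉ = [ (λ x∈A₁ → ⊥-elim (x∉ x∈A₁)) , id ]′ (x∈p∪q⁻ A₁ A₂ x∈)
    f∈E : ∀ {x} → x ∈ A₁ ∪ A₂ → f x ∈ E x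
    f∈E {x} x∈ with x ∈? A₁
    ... | yes x∈A₁ = f₁∈E x∈A₁
    ... | no x∉A₁ = p─q⊆p (E x) Y (f₂∈E (from-A₂ x∈ x∉A₁))
    separated : ∀ {x y} → x ∈ A₁ → y ∈ A₁ ∪ A₂ → y ∉ A₁ → f₁ x ≢ f₂ y
    separated x∈ y∈ y∉ eq = proj₂ (x∈p─q⁻ _ Y (f₂∈E (from-A₂ y∈ y∉))) (subst (_∈ Y) eq (f₁∈Y x∈))
    f-inj : InjectiveOn (A₁ ∪ A₂) f
    f-inj {x} {y} x∈A₁∪A₂ y∈A₁∪A₂ eq with x ∈? A₁ | y ∈? A₁
    ... | yes x∈A₁ | yes y∈A₁ = f₁-inj x∈A₁ y∈A₁ eq
    ... | yes x∈A₁ | no y∉A₁ = ⊥-elim (separated x∈A₁ y∈A₁∪A₂ y∉A₁ eq)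
    ... | no x∉A₁ | yes y∈A₁ = ⊥-elim (separated y∈A₁ x∈A₁∪A₂ x∉A₁ (sym eq))
    ... | no x∉A₁ | no y∉A₁ = f₂-inj (from-A₂ x∈A₁∪A₂ x∉A₁) (from-A₂ y∈A₁∪A₂ y∉A₁) eq

  tight-residual : ∀ {E A X₀} → Tight E A X₀ → HallCondition E A →
                   HallCondition (E ⊖ Neighbours E X₀) (A ─ X₀)
  tight-residual {E} {A} {X₀} (X₀⊆A , _ , _ , ∣X₀∣≡∣NX₀∣) hallE Z Z⊆A─X₀ =
    ℕP.+-cancelʳ-≤ ∣ X₀ ∣ _ _ (begin
      ∣ Z ∣ + ∣ X₀ ∣                                  ≡⟨ sym (∣p∪q∣≡∣p∣+∣q∣ disjoint) ⟩
      ∣ Z ∪ X₀ ∣                                      ≤⟨ hallE (Z ∪ X₀) Z∪X₀⊆A ⟩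
      ∣ Neighbours E (Z ∪ X₀) ∣                       ≤⟨ p⊆q⇒∣p∣≤∣q∣ (Neighbours-⊖ E⊆NX₀) ⟩
      ∣ Neighbours E′ Z ∪ Neighbours E X₀ ∣            ≤⟨ ∣p∪q∣≤∣p∣+∣q∣ (Neighbours E′ Z) _ ⟩
      ∣ Neighbours E′ Z ∣ + ∣ Neighbours E X₀ ∣        ≡⟨ cong (∣ Neighbours E′ Z ∣ +_) (sym ∣X₀∣≡∣NX₀∣) ⟩
      ∣ Neighbours E′ Z ∣ + ∣ X₀ ∣                     ∎)
    where
    open ℕP.≤-Reasoning
    E′ : Fin m → Subset r
    E′ = E ⊖ Neighbours E X₀
    disjoint : Empty (Z ∩ X₀)
    disjoint (x , x∈) = let x∈Z , x∈X₀ = x∈p∩q⁻ Z X₀ x∈ in proj₂ (x∈p─q⁻ A X₀ (Z⊆A─X₀ x∈Z)) x∈X₀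
    Z∪X₀⊆A : Z ∪ X₀ ⊆ A
    Z∪X₀⊆A x∈ = [ proj₁ ∘ x∈p─q⁻ A X₀ ∘ Z⊆A─X₀ , X₀⊆A ]′ (x∈p∪q⁻ Z X₀ x∈)
    E⊆NX₀ : ∀ {x} → x ∈ Z ∪ X₀ → x ∉ Z → E x ⊆ Neighbours E X₀
    E⊆NX₀ x∈ x∉Z = [ (λ x∈Z → ⊥-elim (x∉Z x∈Z)) , (λ x∈X₀ → ∈-Neighbours⁺ x∈X₀) ]′ (x∈p∪q⁻ Z X₀ x∈)

  slack-residual : ∀ {E A a} b → a ∈ A → (∀ X → ¬ Tight E A X) → HallCondition E A →
                   HallCondition (E ⊖ ⁅ b ⁆) (A - a)
  slack-residual {E} {A} {a} b a∈A no-tight hallE Z Z⊆A-a with nonempty? Z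
  ... | no empty = ℕP.≤-trans (ℕP.≤-reflexive (Empty⇒∣p∣≡0 empty)) z≤n
  ... | yes nonempty = ℕP.+-cancelʳ-≤ 1 _ _ (begin
      ∣ Z ∣ + 1                               ≡⟨ ℕP.+-comm ∣ Z ∣ 1 ⟩
      suc ∣ Z ∣                               ≤⟨ ℕP.≤∧≢⇒< (hallE Z Z⊆A) not-tight ⟩
      ∣ Neighbours E Z ∣                      ≤⟨ p⊆q⇒∣p∣≤∣q∣ (Neighbours-⊖ {Y = ⁅ b ⁆} λ x∈ x∉ → ⊥-elim (x∉ x∈)) ⟩
      ∣ Neighbours (E ⊖ ⁅ b ⁆) Z ∪ ⁅ b ⁆ ∣     ≤⟨ ∣p∪q∣≤∣p∣+∣q∣ (Neighbours (E ⊖ ⁅ b ⁆) Z) _ ⟩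
      ∣ Neighbours (E ⊖ ⁅ b ⁆) Z ∣ + ∣ ⁅ b ⁆ ∣ ≡⟨ cong (∣ Neighbours (E ⊖ ⁅ b ⁆) Z ∣ +_) (∣⁅x⁆∣≡1 b) ⟩
      ∣ Neighbours (E ⊖ ⁅ b ⁆) Z ∣ + 1        ∎)
    where
    open ℕP.≤-Reasoning
    Z⊆A : Z ⊆ A
    Z⊆A = p─q⊆p A ⁅ a ⁆ ∘ Z⊆A-a
    a∉Z : a ∉ Z
    a∉Z a∈Z = proj₂ (x∈p─q⁻ A ⁅ a ⁆ (Z⊆A-a a∈Z)) (x∈⁅x⁆ a)
    not-tight : ∣ Z ∣ ≢ ∣ Neighbours E Z ∣
    not-tight eq = no-tight Z (Z⊆A , nonempty , (a , x∈p∧x∉q⇒x∈p─q a∈A a∉Z) , eq)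

  -- The induction is on the fuel bounding ∣ A ∣; d is the value of the matching off A.
  hall : ∀ fuel {E A} → ∣ A ∣ ≤ fuel → Fin r → HallCondition E A → Matching E A
  hall fuel {E} {A} _ d _ with nonempty? A
  ... | no empty = (λ _ → d) , (λ x∈ → ⊥-elim (empty (_ , x∈))) , λ x∈ → ⊥-elim (empty (_ , x∈))
  hall zero ∣A∣≤0 _ _ | yes (a , a∈A) with () ← ℕP.≤-trans (x∈p⇒∣p-x∣<∣p∣ a∈A) ∣A∣≤0
  hall (suc fuel) {E} {A} ∣A∣≤ d hallE | yes (a , a∈A) with anySubset? (tight? E A)
  ... | yes (X₀ , tight@(X₀⊆A , (x₀ , x₀∈X₀) , (z , z∈A─X₀) , _)) =
    Matching-⊆ (p⊆q∪p─q A X₀) (Matching-∪ M₁ (λ x∈ → ∈-Neighbours⁺ x∈ (proj₁ (proj₂ M₁) x∈)) M₂)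
    where
    M₁ : Matching E X₀
    M₁ = hall fuel (ℕP.≤-pred (ℕP.≤-trans (p⊂q⇒∣p∣<∣q∣ (X₀⊆A , z , x∈p─q⁻ A X₀ z∈A─X₀)) ∣A∣≤)) d
           (λ X X⊆X₀ → hallE X (X₀⊆A ∘ X⊆X₀))
    M₂ : Matching (E ⊖ Neighbours E X₀) (A ─ X₀)
    M₂ = hall fuel (ℕP.≤-pred (ℕP.≤-trans (p∩q≢∅⇒∣p─q∣<∣p∣ A X₀ (x₀ , x∈p∩q⁺ (X₀⊆A x₀∈X₀ , x₀∈X₀))) ∣A∣≤)) d
           (tight-residual tight hallE)
  ... | no no-tight =
    Matching-⊆ (p⊆q∪p─q A ⁅ a ⁆) (Matching-∪ M₁ (λ _ → x∈⁅x⁆ b) M₂)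
    where
    b-neighbour : ∃ λ b → b ∈ Neighbours E ⁅ a ⁆
    b-neighbour = 1≤∣p∣⇒Nonempty _ (subst (_≤ ∣ Neighbours E ⁅ a ⁆ ∣) (∣⁅x⁆∣≡1 a)
                    (hallE ⁅ a ⁆ λ x∈ → subst (_∈ A) (sym (x∈⁅y⁆⇒x≡y a x∈)) a∈A))
    b : Fin r
    b = proj₁ b-neighbour
    b∈Ea : b ∈ E a
    b∈Ea with ∈-Neighbours⁻ (proj₂ b-neighbour)
    ... | x , x∈⁅a⁆ , b∈Ex = subst (λ x → b ∈ E x) (x∈⁅y⁆⇒x≡y a x∈⁅a⁆) b∈Ex
    M₁ : Matching E ⁅ a ⁆
    M₁ = (λ _ → b) , (λ x∈ → subst (λ x → b ∈ E x) (sym (x∈⁅y⁆⇒x≡y a x∈)) b∈Ea) ,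
         λ x∈ y∈ _ → trans (x∈⁅y⁆⇒x≡y a x∈) (sym (x∈⁅y⁆⇒x≡y a y∈))
    M₂ : Matching (E ⊖ ⁅ b ⁆) (A - a)
    M₂ = hall fuel (ℕP.≤-pred (ℕP.≤-trans (x∈p⇒∣p-x∣<∣p∣ a∈A) ∣A∣≤)) d
           (slack-residual b a∈A (λ X t → no-tight (X , t)) hallE)

-- Components of G - T

fold-inflationary-stable : ∀ {n} (f : Subset n → Subset n) → (∀ X → X ⊆ f X) →
                           ∀ X → f (fold X f (suc n)) ≡ fold X f (suc n)
fold-inflationary-stable {n} f inflationary X with stationary-or-growing (suc n)
  where
  stationary-or-growing : ∀ i → f (fold X f i) ≡ fold X f i ⊎ i ≤ ∣ fold X f i ∣
  stationary-or-growing zero = inj₂ z≤n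
  stationary-or-growing (suc i) with stationary-or-growing i
  ... | inj₁ stationary = inj₁ (cong f stationary)
  ... | inj₂ i≤∣Xᵢ∣ with VecP.≡-dec BoolP._≟_ (f (fold X f i)) (fold X f i)
  ...   | yes stationary = inj₁ (cong f stationary)
  ...   | no moving = inj₂ (ℕP.≤-trans (s≤s i≤∣Xᵢ∣)
                               (p⊂q⇒∣p∣<∣q∣ (⊆∧≢⇒⊂ (inflationary _) (moving ∘ sym))))
... | inj₁ stationary = stationary
... | inj₂ too-big = ⊥-elim (ℕP.1+n≰n (ℕP.≤-trans too-big (∣p∣≤n (fold X f (suc n)))))

fold-inflationary : ∀ {n} (f : Subset n → Subset n) → (∀ X → X ⊆ f X) → ∀ X i → X ⊆ fold X f i
fold-inflationary f inflationary X zero = id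
fold-inflationary f inflationary X (suc i) = inflationary _ ∘ fold-inflationary f inflationary X i

module Components {n} (G : Graph n) (T : Subset n) where

  Reach-target∉ : ∀ {u v} → Reach G T u v → v ∉ T
  Reach-target∉ (here v∉T) = v∉T
  Reach-target∉ (step _ _ v∉T) = v∉T

  Reach-trans : ∀ {u v w} → Reach G T u v → Reach G T v w → Reach G T u w
  Reach-trans r (here _) = r
  Reach-trans r (step s vw w∉T) = step (Reach-trans r s) vw w∉T

  Reach-sym : ∀ {u v} → Reach G T u v → Reach G T v u
  Reach-sym (here u∉T) = here u∉T
  Reach-sym (step r vw w∉T) =
    Reach-trans (step (here w∉T) (trans (Graph.sym G _ _) vw) (Reach-target∉ r)) (Reach-sym r)

  grow : Subset n → Subset n
  grow X = X ∪ select (λ w → ¬? (w ∈? T) ×-dec FinP.any? (λ u → u ∈? X ×-dec adj G u w BoolP.≟ true))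

  grow-inflationary : ∀ X → X ⊆ grow X
  grow-inflationary X = p⊆p∪q _

  ∈-grow⁺ : ∀ {X u w} → u ∈ X → adj G u w ≡ true → w ∉ T → w ∈ grow X
  ∈-grow⁺ {X} {u} {w} u∈X uw w∉T = x∈p∪q⁺ (inj₂ (∈-select⁺
    (λ w → ¬? (w ∈? T) ×-dec FinP.any? (λ u → u ∈? X ×-dec adj G u w BoolP.≟ true)) (w∉T , u , u∈X , uw)))

  ∈-grow⁻ : ∀ {X w} → w ∈ grow X → w ∈ X ⊎ (w ∉ T × ∃ λ u → u ∈ X × adj G u w ≡ true)
  ∈-grow⁻ {X} w∈ with x∈p∪q⁻ X _ w∈
  ... | inj₁ w∈X = inj₁ w∈X
  ... | inj₂ w∈new = inj₂ (∈-select⁻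
    (λ w → ¬? (w ∈? T) ×-dec FinP.any? (λ u → u ∈? X ×-dec adj G u w BoolP.≟ true)) w∈new)

  opaque
    component : Fin n → Subset n
    component v = fold (⁅ v ⁆ ─ T) grow (suc n)

    component-closed : ∀ {v u w} → u ∈ component v → adj G u w ≡ true → w ∉ T → w ∈ component v
    component-closed {v} u∈ uw w∉T =
      subst (_ ∈_) (fold-inflationary-stable grow grow-inflationary (⁅ v ⁆ ─ T)) (∈-grow⁺ u∈ uw w∉T)

    Reach⇒∈component : ∀ {v w} → Reach G T v w → w ∈ component v
    Reach⇒∈component {v} (here v∉T) =
      fold-inflationary grow grow-inflationary (⁅ v ⁆ ─ T) (suc n) (x∈p∧x∉q⇒x∈p─q (x∈⁅x⁆ v) v∉T)
    Reach⇒∈component (step r uw w∉T) = component-closed (Reach⇒∈component r) uw w∉T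

    ∈component⇒Reach : ∀ {v w} → w ∈ component v → Reach G T v w
    ∈component⇒Reach {v} = reached (suc n)
      where
      reached : ∀ i {w} → w ∈ fold (⁅ v ⁆ ─ T) grow i → Reach G T v w
      reached zero w∈ with x∈p─q⁻ ⁅ v ⁆ T w∈
      ... | w∈⁅v⁆ , w∉T rewrite x∈⁅y⁆⇒x≡y v w∈⁅v⁆ = here w∉T
      reached (suc i) w∈ with ∈-grow⁻ w∈
      ... | inj₁ w∈Xᵢ = reached i w∈Xᵢ
      ... | inj₂ (w∉T , u , u∈Xᵢ , uw) = step (reached i u∈Xᵢ) uw w∉T

  Reach⇒component≡ : ∀ {u v} → Reach G T u v → component u ≡ component v
  Reach⇒component≡ r = ⊆-antisym
    (λ w∈ → Reach⇒∈component (Reach-trans (Reach-sym r) (∈component⇒Reach w∈)))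
    (λ w∈ → Reach⇒∈component (Reach-trans r (∈component⇒Reach w∈)))

  component-isComponent : ∀ {v} → v ∉ T → Component G T (component v)
  component-isComponent {v} v∉T =
    (v , Reach⇒∈component (here v∉T)) ,
    (λ w w∈ → Reach-target∉ (∈component⇒Reach w∈)) ,
    (λ u w u∈ w∈ → Reach-trans (Reach-sym (∈component⇒Reach u∈)) (∈component⇒Reach w∈)) ,
    (λ u w u∈ r → Reach⇒∈component (Reach-trans (∈component⇒Reach u∈) r))

  Component⇒≡component : ∀ {C v} → Component G T C → v ∈ C → C ≡ component v
  Component⇒≡component (_ , _ , connected , closed) v∈C = ⊆-antisym
    (λ w∈C → Reach⇒∈component (connected _ _ v∈C w∈C))
    (λ w∈ → closed _ _ v∈C (∈component⇒Reach w∈))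

  rep : Fin n → Fin n
  rep v = choice v (component v)

  rep∈component : ∀ {v} → v ∉ T → rep v ∈ component v
  rep∈component {v} v∉T = choice∈ v (v , Reach⇒∈component (here v∉T))

  Reach⇒rep≡ : ∀ {u v} → Reach G T u v → rep u ≡ rep v
  Reach⇒rep≡ {u} {v} r rewrite Reach⇒component≡ r =
    choice-default-irrelevant u v (v , Reach⇒∈component (here (Reach-target∉ r)))

  rep≡⇒Reach : ∀ {u v} → u ∉ T → v ∉ T → rep u ≡ rep v → Reach G T u v
  rep≡⇒Reach u∉T v∉T eq = Reach-trans (∈component⇒Reach (rep∈component u∉T))
    (subst (λ w → Reach G T w _) (sym eq) (Reach-sym (∈component⇒Reach (rep∈component v∉T))))

  leaders : Subset n
  leaders = select (λ v → ¬? (v ∈? T) ×-dec rep v Fin.≟ v)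

  rep∈leaders : ∀ {v} → v ∉ T → rep v ∈ leaders
  rep∈leaders {v} v∉T = ∈-select⁺ (λ v → ¬? (v ∈? T) ×-dec rep v Fin.≟ v)
    (Reach-target∉ v↝rep , sym (Reach⇒rep≡ v↝rep))
    where
    v↝rep : Reach G T v (rep v)
    v↝rep = ∈component⇒Reach (rep∈component v∉T)

  ∈leaders⁻ : ∀ {v} → v ∈ leaders → v ∉ T × rep v ≡ v
  ∈leaders⁻ = ∈-select⁻ (λ v → ¬? (v ∈? T) ×-dec rep v Fin.≟ v)

  numComponents : NumComponents G T ∣ leaders ∣
  numComponents = cs , cs-injective , (λ i → component-isComponent (proj₁ (leader i))) , cover
    where
    leader : ∀ i → enumerate leaders i ∉ T × rep (enumerate leaders i) ≡ enumerate leaders i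
    leader i = ∈leaders⁻ (enumerate∈ leaders i)
    cs : Fin ∣ leaders ∣ → Subset n
    cs i = component (enumerate leaders i)
    cs-injective : ∀ {i j} → cs i ≡ cs j → i ≡ j
    cs-injective {i} {j} eq = enumerate-injective leaders (begin
      enumerate leaders i                          ≡⟨ sym (proj₂ (leader i)) ⟩
      choice (enumerate leaders i) (cs i)          ≡⟨ cong (choice _) eq ⟩
      choice (enumerate leaders i) (cs j)          ≡⟨ choice-default-irrelevant _ _ (_ , rep∈ j) ⟩
      rep (enumerate leaders j)                    ≡⟨ proj₂ (leader j) ⟩
      enumerate leaders j                          ∎)
      where
      open ≡-Reasoning
      rep∈ : ∀ j → rep (enumerate leaders j) ∈ cs j
      rep∈ j = rep∈component (proj₁ (leader j))
    cover : ∀ C → Component G T C → ∃ λ i → cs i ≡ C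
    cover C isC@((v , v∈C) , C∩T≡∅ , _) = index leaders rep-v∈leaders , (begin
      component (enumerate leaders (index leaders _))   ≡⟨ cong component (enumerate∘index leaders rep-v∈leaders) ⟩
      component (rep v)                                 ≡⟨ sym (Reach⇒component≡ (∈component⇒Reach rep-v∈)) ⟩
      component v                                       ≡⟨ sym (Component⇒≡component isC v∈C) ⟩
      C                                                 ∎)
      where
      open ≡-Reasoning
      v∉T : v ∉ T
      v∉T = C∩T≡∅ v v∈C
      rep-v∈leaders : rep v ∈ leaders
      rep-v∈leaders = rep∈leaders v∉T
      rep-v∈ : rep v ∈ component v
      rep-v∈ = rep∈component v∉T

  Scattered : ∀ {m} → (Fin m → Fin n) → Set
  Scattered g = (∀ i → g i ∉ T) × (∀ i j → Reach G T (g i) (g j) → i ≡ j)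

  scattered⇒≤∣leaders∣ : ∀ {m} {g : Fin m → Fin n} → Scattered g → m ≤ ∣ leaders ∣
  scattered⇒≤∣leaders∣ {m} {g} (g∉T , g-separated) = subst (_≤ ∣ leaders ∣) (∣⊤∣≡n m)
    (injectiveOn⇒∣p∣≤∣q∣ {p = ⊤} (rep ∘ g) (λ {i} _ → rep∈leaders (g∉T i))
      λ {i} {j} _ _ eq → g-separated i j (rep≡⇒Reach (g∉T i) (g∉T j) eq))

toℚᵘ-ℕtoℚ : ∀ k → toℚᵘ (ℕtoℚ k) ≡ ℚᵘ.mkℚᵘ (ℤ.+ k) 0
toℚᵘ-ℕtoℚ k = cong toℚᵘ (ℚP.normalize-coprime (gcd≡1⇒coprime (gcd-zeroʳ k)))

ℕtoℚ-*-cancel-≤ : ∀ a b c → ℕtoℚ a ℚ.* ℕtoℚ b ℚ.≤ ℕtoℚ c → a * b ≤ c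
ℕtoℚ-*-cancel-≤ a b c ab≤c with unnormalised
  where
  unnormalised : ℚᵘ.mkℚᵘ (ℤ.+ a) 0 ℚᵘ.* ℚᵘ.mkℚᵘ (ℤ.+ b) 0 ℚᵘ.≤ ℚᵘ.mkℚᵘ (ℤ.+ c) 0
  unnormalised = subst₂ (λ x y → x ℚᵘ.* ℚᵘ.mkℚᵘ (ℤ.+ b) 0 ℚᵘ.≤ y) (toℚᵘ-ℕtoℚ a) (toℚᵘ-ℕtoℚ c)
    (subst (λ y → toℚᵘ (ℕtoℚ a) ℚᵘ.* y ℚᵘ.≤ toℚᵘ (ℕtoℚ c)) (toℚᵘ-ℕtoℚ b)
      (ℚᵘP.≤-respˡ-≃ (ℚP.toℚᵘ-homo-* (ℕtoℚ a) (ℕtoℚ b)) (ℚP.toℚᵘ-mono-≤ ab≤c)))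
... | ℚᵘ.*≤* ab≤c′ = ℤP.drop‿+≤+
  (subst₂ ℤ._≤_ (trans (ℤP.*-identityʳ _) (sym (ℤP.pos-* a b))) (ℤP.*-identityʳ _) ab≤c′)

module _ {n} {G : Graph n} {t : ℚ} (4≤t : ℕtoℚ 4 ℚ.≤ t) (tough : Tough t G) where

  open Components G using (Scattered; leaders; numComponents; scattered⇒≤∣leaders∣)

  scattered⇒4*≤∣T∣ : ∀ T {m} {g : Fin m → Fin n} → 2 ≤ m → Scattered T g → 4 * m ≤ ∣ T ∣
  scattered⇒4*≤∣T∣ T {suc (suc m)} {g} (s≤s (s≤s z≤n)) scattered@(g∉T , g-separated) =
    ℕP.≤-trans (ℕP.*-monoʳ-≤ 4 (scattered⇒≤∣leaders∣ T scattered))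
      (ℕtoℚ-*-cancel-≤ 4 k ∣ T ∣ (ℚP.≤-trans (ℚP.*-monoʳ-≤-nonNeg (ℕtoℚ k) {{ℚP.normalize-nonNeg k 1}} 4≤t)
        (tough T k cutset (numComponents T))))
    where
    k : ℕ
    k = ∣ leaders T ∣
    cutset : Cutset G T
    cutset = g zero , g (suc zero) , g∉T zero , g∉T (suc zero) ,
             λ r → case g-separated zero (suc zero) r of λ ()

anyFin-intro : ∀ {n} (f : Fin n → Bool) x → f x ≡ true → anyFin f ≡ true
anyFin-intro f zero fx rewrite fx = refl
anyFin-intro f (suc x) fx rewrite anyFin-intro (f ∘ suc) x fx = BoolP.∨-zeroʳ (f zero)

∉⇒lookup≡false : ∀ {n} {p : Subset n} {x} → x ∉ p → lookup p x ≡ false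
∉⇒lookup≡false {p = p} {x} x∉ with lookup p x in eq
... | true = ⊥-elim (x∉ (lookup⇒[]= x p eq))
... | false = refl

∈-Nbr⁺ : ∀ {n} (G : Graph n) {X : Subset n} {u v} → u ∈ X → adj G u v ≡ true → v ∉ X → v ∈ Nbr G X
∈-Nbr⁺ G {X} {u} {v} u∈X uv v∉X = lookup⇒[]= v (Nbr G X)
  (trans (lookup∘tabulate _ v) (cong₂ _∧_ (cong not (∉⇒lookup≡false v∉X))
    (anyFin-intro (λ u → lookup X u ∧ adj G u v) u (cong₂ _∧_ ([]=⇒lookup u∈X) uv))))

⁅x⁆∪[p-x]≡p : ∀ {n} {p : Subset n} {x} → x ∈ p → ⁅ x ⁆ ∪ (p - x) ≡ p
⁅x⁆∪[p-x]≡p {p = p} {x} x∈ = ⊆-antisym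
  (λ y∈ → [ (λ y∈⁅x⁆ → subst (_∈ p) (sym (x∈⁅y⁆⇒x≡y x y∈⁅x⁆)) x∈) , p─q⊆p p ⁅ x ⁆ ]′ (x∈p∪q⁻ ⁅ x ⁆ (p - x) y∈))
  (p⊆q∪p─q p ⁅ x ⁆)

⁅x⁆∩[p-x]≡⊥ : ∀ {n} (p : Subset n) x → ⁅ x ⁆ ∩ (p - x) ≡ ⊥
⁅x⁆∩[p-x]≡⊥ p x = Empty-unique λ (y , y∈) →
  let y∈⁅x⁆ , y∈p-x = x∈p∩q⁻ ⁅ x ⁆ (p - x) y∈ in proj₂ (x∈p─q⁻ p ⁅ x ⁆ y∈p-x) y∈⁅x⁆

pair-isGenK12 : ∀ {n} (G : Graph n) {X : Subset n} {x₁ x₂ s₁ s₂} →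
                x₁ ∈ X → x₂ ∈ X → s₁ ∉ X → s₂ ∉ X → adj G x₁ s₁ ≡ true → adj G x₂ s₂ ≡ true →
                s₁ ≢ s₂ → (2 ≤ ∣ X ∣ → x₁ ≢ x₂) → GenK12 G X (⁅ s₁ ⁆ ∪ ⁅ s₂ ⁆)
pair-isGenK12 G {X} {x₁} {x₂} {s₁} {s₂} x₁∈ x₂∈ s₁∉ s₂∉ x₁s₁ x₂s₂ s₁≢s₂ x₁≢x₂ =
  (x₁ , x₁∈) , (λ {s} → pair⊆Nbr {s}) , ∣⁅x⁆∪⁅y⁆∣≡2 s₁≢s₂ ,
  λ 2≤∣X∣ → ⁅ x₁ ⁆ , X - x₁ , ⁅ s₁ ⁆ , ⁅ s₂ ⁆ ,
    ((x₁ , x∈⁅x⁆ x₁) , (x₂ , x₂∈X-x₁ 2≤∣X∣) , ⁅x⁆∩[p-x]≡⊥ X x₁ , ⁅x⁆∪[p-x]≡p x₁∈) ,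
    ((s₁ , x∈⁅x⁆ s₁) , (s₂ , x∈⁅x⁆ s₂) , ⁅x⁆∩⁅y⁆≡⊥ s₁≢s₂ , refl) ,
    (λ {s} → ⁅s₁⁆⊆ {s}) , (λ {s} → ⁅s₂⁆⊆ 2≤∣X∣ {s}) ,
    ∣⁅x⁆∣≡1 s₁ , ∣⁅x⁆∣≡1 s₂
  where
  pair⊆Nbr : ⁅ s₁ ⁆ ∪ ⁅ s₂ ⁆ ⊆ Nbr G X
  pair⊆Nbr s∈ with x∈p∪q⁻ ⁅ s₁ ⁆ ⁅ s₂ ⁆ s∈
  ... | inj₁ s∈⁅s₁⁆ rewrite x∈⁅y⁆⇒x≡y s₁ s∈⁅s₁⁆ = ∈-Nbr⁺ G x₁∈ x₁s₁ s₁∉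
  ... | inj₂ s∈⁅s₂⁆ rewrite x∈⁅y⁆⇒x≡y s₂ s∈⁅s₂⁆ = ∈-Nbr⁺ G x₂∈ x₂s₂ s₂∉
  x₂∈X-x₁ : 2 ≤ ∣ X ∣ → x₂ ∈ X - x₁
  x₂∈X-x₁ 2≤∣X∣ = x∈p∧x≢y⇒x∈p-y x₂∈ (x₁≢x₂ 2≤∣X∣ ∘ sym)
  ⁅s₁⁆⊆ : ⁅ s₁ ⁆ ⊆ Nbr G ⁅ x₁ ⁆ ∩ (⁅ s₁ ⁆ ∪ ⁅ s₂ ⁆)
  ⁅s₁⁆⊆ s∈ rewrite x∈⁅y⁆⇒x≡y s₁ s∈ = x∈p∩q⁺
    (∈-Nbr⁺ G (x∈⁅x⁆ x₁) x₁s₁ (λ s₁∈ → s₁∉ (subst (_∈ X) (sym (x∈⁅y⁆⇒x≡y x₁ s₁∈)) x₁∈)) ,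
     x∈p∪q⁺ (inj₁ (x∈⁅x⁆ s₁)))
  ⁅s₂⁆⊆ : 2 ≤ ∣ X ∣ → ⁅ s₂ ⁆ ⊆ Nbr G (X - x₁) ∩ (⁅ s₁ ⁆ ∪ ⁅ s₂ ⁆)
  ⁅s₂⁆⊆ 2≤∣X∣ s∈ rewrite x∈⁅y⁆⇒x≡y s₂ s∈ = x∈p∩q⁺
    (∈-Nbr⁺ G (x₂∈X-x₁ 2≤∣X∣) x₂s₂ (s₂∉ ∘ p─q⊆p X ⁅ x₁ ⁆) , x∈p∪q⁺ (inj₂ (x∈⁅x⁆ s₂)))

-- The auxiliary bipartite graph

module Copies {n : ℕ} where

  orig twin : Fin n → Fin (n + n)
  orig x = x ↑ˡ n
  twin x = n ↑ʳ x

  data Copy : Fin (n + n) → Set where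
    orig-copy : ∀ x → Copy (orig x)
    twin-copy : ∀ x → Copy (twin x)

  copy : ∀ v → Copy v
  copy v with Fin.splitAt n v in eq
  ... | inj₁ x = subst Copy (FinP.splitAt⁻¹-↑ˡ eq) (orig-copy x)
  ... | inj₂ x = subst Copy (FinP.splitAt⁻¹-↑ʳ eq) (twin-copy x)

  vertex : Fin (n + n) → Fin n
  vertex v = [ id , id ]′ (Fin.splitAt n v)

  vertex-orig : ∀ x → vertex (orig x) ≡ x
  vertex-orig x = cong [ id , id ]′ (FinP.splitAt-↑ˡ n x n)

  vertex-twin : ∀ x → vertex (twin x) ≡ x
  vertex-twin x = cong [ id , id ]′ (FinP.splitAt-↑ʳ n n x)

  orig-injective : ∀ {x y} → orig x ≡ orig y → x ≡ y
  orig-injective = FinP.↑ˡ-injective n _ _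

  orig≢twin : ∀ {x y} → orig x ≢ twin y
  orig≢twin {x} {y} eq
    with trans (sym (FinP.splitAt-↑ˡ n x n)) (trans (cong (Fin.splitAt n) eq) (FinP.splitAt-↑ʳ n n y))
  ... | ()

  orig-or-twin : ∀ v → v ≡ orig (vertex v) ⊎ v ≡ twin (vertex v)
  orig-or-twin v with copy v
  ... | orig-copy x = inj₁ (cong orig (sym (vertex-orig x)))
  ... | twin-copy x = inj₂ (cong twin (sym (vertex-twin x)))

  ≡twin⇒≡twin∘vertex : ∀ {v x} → v ≡ twin x → v ≡ twin (vertex v)
  ≡twin⇒≡twin∘vertex {x = x} refl = cong twin (sym (vertex-twin x))

  IsOrig : Fin (n + n) → Set
  IsOrig v = ∃ λ x → v ≡ orig x

  isOrig? : Decidable IsOrig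
  isOrig? v with copy v
  ... | orig-copy x = yes (x , refl)
  ... | twin-copy x = no λ (y , eq) → orig≢twin (sym eq)

  ¬IsOrig⇒twin : ∀ {v} → ¬ IsOrig v → ∃ λ x → v ≡ twin x
  ¬IsOrig⇒twin {v} ¬orig with copy v
  ... | orig-copy x = ⊥-elim (¬orig (x , refl))
  ... | twin-copy x = x , refl

module Auxiliary {n} (G : Graph n) (S : Subset n) where

  open Components G S public
  open Copies {n} public

  Trivial : Fin n → Set
  Trivial x = ∣ component x ∣ ≤ 1

  ∈component : ∀ {x} → x ∉ S → x ∈ component x
  ∈component x∉S = Reach⇒∈component (here x∉S)

  rep≡⇒∈component : ∀ {x y} → x ∉ S → y ∉ S → rep y ≡ rep x → y ∈ component x
  rep≡⇒∈component x∉S y∉S eq = Reach⇒∈component (rep≡⇒Reach x∉S y∉S (sym eq))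

  second : Fin n → Fin n
  second v = choice v (component v - rep v)

  second∈ : ∀ {v} → 2 ≤ ∣ component v ∣ → second v ∈ component v - rep v
  second∈ {v} nontrivial = choice∈ v (2≤∣p∣⇒Nonempty[p-x] (rep v) nontrivial)

  Reach⇒second≡ : ∀ {u v} → Reach G S u v → 2 ≤ ∣ component u ∣ → second u ≡ second v
  Reach⇒second≡ {u} {v} r nontrivial = trans
    (cong₂ (λ C c → choice u (C - c)) (Reach⇒component≡ r) (Reach⇒rep≡ r))
    (choice-default-irrelevant u v
      (2≤∣p∣⇒Nonempty[p-x] (rep v) (subst (λ C → 2 ≤ ∣ C ∣) (Reach⇒component≡ r) nontrivial)))

  Dummy : Fin n → Set
  Dummy u = u ∉ S × u ≢ rep u × u ≢ second u

  dummy? : Decidable Dummy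
  dummy? u = ¬? (u ∈? S) ×-dec ¬? (u Fin.≟ rep u) ×-dec ¬? (u Fin.≟ second u)

  dummies : Fin n → Subset n
  dummies r = select (λ u → dummy? u ×-dec rep u Fin.≟ r)

  ∈dummies⁻ : ∀ {u r} → u ∈ dummies r → Dummy u × rep u ≡ r
  ∈dummies⁻ = ∈-select⁻ (λ u → dummy? u ×-dec rep u Fin.≟ _)

  ∈dummies⁺ : ∀ {u r} → Dummy u → rep u ≡ r → u ∈ dummies r
  ∈dummies⁺ dummy eq = ∈-select⁺ (λ u → dummy? u ×-dec rep u Fin.≟ _) (dummy , eq)

  dummy⇒nontrivial : ∀ {u} → Dummy u → 2 ≤ ∣ component u ∣
  dummy⇒nontrivial (u∉S , u≢rep , _) = two-members⇒2≤∣p∣ (∈component u∉S) (rep∈component u∉S) u≢rep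

  S-neighbours : Fin n → Subset n
  S-neighbours x = select (λ s → s ∈? S ×-dec adj G x s BoolP.≟ true)

  dummy-slots : Fin (n + n) → Subset n
  dummy-slots v = [ dummies ∘ rep , (λ _ → ⊥) ]′ (Fin.splitAt n v)

  dummy-slots-orig : ∀ x → dummy-slots (orig x) ≡ dummies (rep x)
  dummy-slots-orig x = cong [ dummies ∘ rep , (λ _ → ⊥) ]′ (FinP.splitAt-↑ˡ n x n)

  dummy-slots-twin : ∀ x → dummy-slots (twin x) ≡ ⊥
  dummy-slots-twin x = cong [ dummies ∘ rep , (λ _ → ⊥) ]′ (FinP.splitAt-↑ʳ n n x)

  E : Fin (n + n) → Subset (n + n)
  E v = S-neighbours (vertex v) ++ dummy-slots v

  orig∈E⁺ : ∀ {v s} → s ∈ S → adj G (vertex v) s ≡ true → orig s ∈ E v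
  orig∈E⁺ {v} s∈S vs = ∈-++⁺ˡ (∈-select⁺ (λ s → s ∈? S ×-dec adj G (vertex v) s BoolP.≟ true) (s∈S , vs))

  orig∈E⁻ : ∀ {v s} → orig s ∈ E v → s ∈ S × adj G (vertex v) s ≡ true
  orig∈E⁻ {v} s∈ = ∈-select⁻ (λ s → s ∈? S ×-dec adj G (vertex v) s BoolP.≟ true) (∈-++⁻ˡ _ s∈)

  twin∈E⁺ : ∀ {x u} → u ∈ dummies (rep x) → twin u ∈ E (orig x)
  twin∈E⁺ {x} u∈ = ∈-++⁺ʳ _ (subst (_ ∈_) (sym (dummy-slots-orig x)) u∈)

  twin∈E⁻ : ∀ {v u} → twin u ∈ E v → ∃ λ x → v ≡ orig x × u ∈ dummies (rep x)
  twin∈E⁻ {v} u∈ with copy v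
  ... | orig-copy x = x , refl , subst (_ ∈_) (dummy-slots-orig x) (∈-++⁻ʳ _ u∈)
  ... | twin-copy x = ⊥-elim (∉⊥ (subst (_ ∈_) (dummy-slots-twin x) (∈-++⁻ʳ _ u∈)))

  A : Subset (n + n)
  A = select (λ x → ¬? (x ∈? S)) ++ select (λ x → ¬? (x ∈? S) ×-dec ∣ component x ∣ ℕ.≤? 1)

  orig∈A⁺ : ∀ {x} → x ∉ S → orig x ∈ A
  orig∈A⁺ x∉S = ∈-++⁺ˡ (∈-select⁺ (λ x → ¬? (x ∈? S)) x∉S)

  twin∈A⁺ : ∀ {x} → x ∉ S → Trivial x → twin x ∈ A
  twin∈A⁺ x∉S trivial = ∈-++⁺ʳ _ (∈-select⁺ (λ x → ¬? (x ∈? S) ×-dec ∣ component x ∣ ℕ.≤? 1) (x∉S , trivial))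

  twin∈A⁻ : ∀ {x} → twin x ∈ A → Trivial x
  twin∈A⁻ x∈ = proj₂ (∈-select⁻ (λ x → ¬? (x ∈? S) ×-dec ∣ component x ∣ ℕ.≤? 1) (∈-++⁻ʳ _ x∈))

  ∈A⇒vertex∉S : ∀ {v} → v ∈ A → vertex v ∉ S
  ∈A⇒vertex∉S {v} v∈ with copy v
  ... | orig-copy x rewrite vertex-orig x = ∈-select⁻ (λ x → ¬? (x ∈? S)) (∈-++⁻ˡ _ v∈)
  ... | twin-copy x rewrite vertex-twin x =
          proj₁ (∈-select⁻ (λ x → ¬? (x ∈? S) ×-dec ∣ component x ∣ ℕ.≤? 1) (∈-++⁻ʳ _ v∈))

  left : Fin n → Subset (n + n)
  left r = A ∩ fibre (rep ∘ vertex) r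

  ∈left⁺ : ∀ {v r} → v ∈ A → rep (vertex v) ≡ r → v ∈ left r
  ∈left⁺ v∈A eq = x∈p∩q⁺ (v∈A , ∈fibre⁺ {f = rep ∘ vertex} eq)

  ∈left⁻ : ∀ {v r} → v ∈ left r → v ∈ A × rep (vertex v) ≡ r
  ∈left⁻ {r = r} v∈ with x∈p∩q⁻ A _ v∈
  ... | v∈A , v∈fibre = v∈A , ∈fibre⁻ {f = rep ∘ vertex} v∈fibre

  ∈left⇒∈component : ∀ {x v} → x ∉ S → v ∈ left (rep x) → vertex v ∈ component x
  ∈left⇒∈component x∉S v∈ with ∈left⁻ v∈
  ... | v∈A , eq = rep≡⇒∈component x∉S (∈A⇒vertex∉S v∈A) eq

  dummy⇒¬Trivial : ∀ {u x} → Dummy u → x ∉ S → rep u ≡ rep x → ¬ Trivial x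
  dummy⇒¬Trivial dummy@(u∉S , _) x∉S eq trivial = ℕP.≤⇒≯ trivial
    (subst (λ C → 2 ≤ ∣ C ∣) (Reach⇒component≡ (rep≡⇒Reach u∉S x∉S eq)) (dummy⇒nontrivial dummy))

  dummies⊆component : ∀ {x} → x ∉ S → dummies (rep x) ⊆ component x
  dummies⊆component x∉S u∈ with ∈dummies⁻ u∈
  ... | (u∉S , _) , eq = rep≡⇒∈component x∉S u∉S eq

  dummies-trivial : ∀ {x} → x ∉ S → Trivial x → Empty (dummies (rep x))
  dummies-trivial x∉S trivial (u , u∈) with ∈dummies⁻ u∈
  ... | dummy , eq = dummy⇒¬Trivial dummy x∉S eq trivial

  left-trivial : ∀ {x} → x ∉ S → Trivial x → left (rep x) ≡ ⁅ orig x ⁆ ∪ ⁅ twin x ⁆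
  left-trivial {x} x∉S trivial = ⊆-antisym ⊆pair pair⊆
    where
    ⊆pair : left (rep x) ⊆ ⁅ orig x ⁆ ∪ ⁅ twin x ⁆
    ⊆pair {v} v∈ with orig-or-twin v | ∣p∣≤1⇒x≡y trivial (∈left⇒∈component x∉S v∈) (∈component x∉S)
    ... | inj₁ v≡orig | vertex-v≡x = x∈p∪q⁺ (inj₁ (x≡y⇒x∈⁅y⁆ (trans v≡orig (cong orig vertex-v≡x))))
    ... | inj₂ v≡twin | vertex-v≡x = x∈p∪q⁺ (inj₂ (x≡y⇒x∈⁅y⁆ (trans v≡twin (cong twin vertex-v≡x))))
    pair⊆ : ⁅ orig x ⁆ ∪ ⁅ twin x ⁆ ⊆ left (rep x)
    pair⊆ v∈ with x∈p∪q⁻ ⁅ orig x ⁆ ⁅ twin x ⁆ v∈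
    ... | inj₁ v∈⁅orig⁆ rewrite x∈⁅y⁆⇒x≡y _ v∈⁅orig⁆ = ∈left⁺ (orig∈A⁺ x∉S) (cong rep (vertex-orig x))
    ... | inj₂ v∈⁅twin⁆ rewrite x∈⁅y⁆⇒x≡y _ v∈⁅twin⁆ = ∈left⁺ (twin∈A⁺ x∉S trivial) (cong rep (vertex-twin x))

  twin∉left : ∀ {x y} → x ∉ S → 2 ≤ ∣ component x ∣ → twin y ∉ left (rep x)
  twin∉left {x} {y} x∉S nontrivial y∈ = ℕP.<⇒≱ (s≤s (twin∈A⁻ (proj₁ (∈left⁻ y∈))))
    (subst (λ C → 2 ≤ ∣ C ∣) (Reach⇒component≡ (∈component⇒Reach y∈C)) nontrivial)
    where
    y∈C : y ∈ component x
    y∈C = subst (_∈ component x) (vertex-twin y) (∈left⇒∈component x∉S y∈)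

  left-vertex-injective : ∀ {x} → x ∉ S → 2 ≤ ∣ component x ∣ → InjectiveOn (left (rep x)) vertex
  left-vertex-injective x∉S nontrivial {v} {w} v∈ w∈ eq with orig-or-twin v | orig-or-twin w
  ... | inj₁ v≡orig | inj₁ w≡orig = trans v≡orig (trans (cong orig eq) (sym w≡orig))
  ... | inj₂ v≡twin | _ = ⊥-elim (twin∉left x∉S nontrivial (subst (_∈ left _) v≡twin v∈))
  ... | _ | inj₂ w≡twin = ⊥-elim (twin∉left x∉S nontrivial (subst (_∈ left _) w≡twin w∈))

  ∣left∣≡∣component∣ : ∀ {x} → x ∉ S → 2 ≤ ∣ component x ∣ → ∣ left (rep x) ∣ ≡ ∣ component x ∣
  ∣left∣≡∣component∣ {x} x∉S nontrivial = ℕP.≤-antisym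
    (injectiveOn⇒∣p∣≤∣q∣ vertex (∈left⇒∈component x∉S) (left-vertex-injective x∉S nontrivial))
    (injectiveOn⇒∣p∣≤∣q∣ orig orig∈left λ _ _ → orig-injective)
    where
    orig∈left : ∀ {y} → y ∈ component x → orig y ∈ left (rep x)
    orig∈left {y} y∈C = ∈left⁺ (orig∈A⁺ (Reach-target∉ (∈component⇒Reach y∈C)))
      (trans (cong rep (vertex-orig y)) (sym (Reach⇒rep≡ (∈component⇒Reach y∈C))))

  component─dummies : ∀ {x} → x ∉ S → 2 ≤ ∣ component x ∣ →
                      component x ─ dummies (rep x) ≡ ⁅ rep x ⁆ ∪ ⁅ second x ⁆
  component─dummies {x} x∉S nontrivial = ⊆-antisym ⊆pair pair⊆
    where
    reached-non-dummy : ∀ {u} → Reach G S x u → u ∉ dummies (rep x) → u ∈ ⁅ rep x ⁆ ∪ ⁅ second x ⁆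
    reached-non-dummy {u} x↝u u∉D with u Fin.≟ rep u | u Fin.≟ second u
    ... | yes u≡rep | _ = x∈p∪q⁺ (inj₁ (x≡y⇒x∈⁅y⁆ (trans u≡rep (sym (Reach⇒rep≡ x↝u)))))
    ... | no _ | yes u≡second = x∈p∪q⁺ (inj₂ (x≡y⇒x∈⁅y⁆ (trans u≡second (sym (Reach⇒second≡ x↝u nontrivial)))))
    ... | no u≢rep | no u≢second =
          ⊥-elim (u∉D (∈dummies⁺ (Reach-target∉ x↝u , u≢rep , u≢second) (sym (Reach⇒rep≡ x↝u))))
    ⊆pair : component x ─ dummies (rep x) ⊆ ⁅ rep x ⁆ ∪ ⁅ second x ⁆
    ⊆pair {u} u∈ with x∈p─q⁻ (component x) _ u∈
    ... | u∈C , u∉D = reached-non-dummy (∈component⇒Reach u∈C) u∉D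
    not-dummy : ∀ {u} → u ≡ rep u ⊎ u ≡ second u → u ∉ dummies (rep x)
    not-dummy u≡ u∈ with ∈dummies⁻ u∈ | u≡
    ... | (_ , u≢rep , _) , _ | inj₁ u≡rep = u≢rep u≡rep
    ... | (_ , _ , u≢second) , _ | inj₂ u≡second = u≢second u≡second
    second∈C : second x ∈ component x
    second∈C = p─q⊆p _ _ (second∈ nontrivial)
    pair⊆ : ⁅ rep x ⁆ ∪ ⁅ second x ⁆ ⊆ component x ─ dummies (rep x)
    pair⊆ u∈ with x∈p∪q⁻ ⁅ rep x ⁆ ⁅ second x ⁆ u∈
    ... | inj₁ u∈⁅rep⁆ rewrite x∈⁅y⁆⇒x≡y _ u∈⁅rep⁆ = x∈p∧x∉q⇒x∈p─q (rep∈component x∉S)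
          (not-dummy (inj₁ (Reach⇒rep≡ (∈component⇒Reach (rep∈component x∉S)))))
    ... | inj₂ u∈⁅second⁆ rewrite x∈⁅y⁆⇒x≡y _ u∈⁅second⁆ = x∈p∧x∉q⇒x∈p─q second∈C
          (not-dummy (inj₂ (Reach⇒second≡ (∈component⇒Reach second∈C) nontrivial)))

  ∣left∣≡∣dummies∣+2 : ∀ {x} → x ∉ S → ∣ left (rep x) ∣ ≡ ∣ dummies (rep x) ∣ + 2
  ∣left∣≡∣dummies∣+2 {x} x∉S with ∣ component x ∣ ℕ.≤? 1
  ... | yes trivial = begin
    ∣ left (rep x) ∣                 ≡⟨ cong ∣_∣ (left-trivial x∉S trivial) ⟩
    ∣ ⁅ orig x ⁆ ∪ ⁅ twin x ⁆ ∣       ≡⟨ ∣⁅x⁆∪⁅y⁆∣≡2 (orig≢twin {x} {x}) ⟩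
    2                                ≡⟨ cong (_+ 2) (sym (Empty⇒∣p∣≡0 (dummies-trivial x∉S trivial))) ⟩
    ∣ dummies (rep x) ∣ + 2          ∎
    where open ≡-Reasoning
  ... | no ¬trivial = begin
    ∣ left (rep x) ∣                                  ≡⟨ ∣left∣≡∣component∣ x∉S nontrivial ⟩
    ∣ C ∣                                             ≡⟨ sym (∣p∩q∣+∣p─q∣≡∣p∣ C D) ⟩
    ∣ C ∩ D ∣ + ∣ C ─ D ∣                              ≡⟨ cong₂ _+_ ∣C∩D∣≡∣D∣ (cong ∣_∣ (component─dummies x∉S nontrivial)) ⟩
    ∣ D ∣ + ∣ ⁅ rep x ⁆ ∪ ⁅ second x ⁆ ∣              ≡⟨ cong (∣ D ∣ +_) (∣⁅x⁆∪⁅y⁆∣≡2 rep≢second) ⟩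
    ∣ D ∣ + 2                                         ∎
    where
    open ≡-Reasoning
    nontrivial : 2 ≤ ∣ component x ∣
    nontrivial = ℕP.≰⇒> ¬trivial
    C D : Subset n
    C = component x
    D = dummies (rep x)
    ∣C∩D∣≡∣D∣ : ∣ C ∩ D ∣ ≡ ∣ D ∣
    ∣C∩D∣≡∣D∣ = ℕP.≤-antisym (∣p∩q∣≤∣q∣ C D)
      (p⊆q⇒∣p∣≤∣q∣ λ u∈D → x∈p∩q⁺ (dummies⊆component x∉S u∈D , u∈D))
    rep≢second : rep x ≢ second x
    rep≢second eq = proj₂ (x∈p─q⁻ C ⁅ rep x ⁆ (second∈ nontrivial)) (subst (_∈ ⁅ rep x ⁆) eq (x∈⁅x⁆ _))

  -- Hall's condition

  module _ (X : Subset (n + n)) (X⊆A : X ⊆ A) where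

    touched : Subset n
    touched = select (λ x → orig x ∈? X ⊎-dec twin x ∈? X)

    ∈touched⁻ : ∀ {x} → x ∈ touched → orig x ∈ X ⊎ twin x ∈ X
    ∈touched⁻ = ∈-select⁻ (λ x → orig x ∈? X ⊎-dec twin x ∈? X)

    ∈touched⇒copy∈X : ∀ {x} → x ∈ touched → ∃ λ w → w ∈ X × vertex w ≡ x
    ∈touched⇒copy∈X {x} x∈ with ∈touched⁻ x∈
    ... | inj₁ orig∈X = orig x , orig∈X , vertex-orig x
    ... | inj₂ twin∈X = twin x , twin∈X , vertex-twin x

    vertex∈touched : ∀ {v} → v ∈ X → vertex v ∈ touched
    vertex∈touched {v} v∈X = ∈-select⁺ (λ x → orig x ∈? X ⊎-dec twin x ∈? X)
      ([ (λ v≡ → inj₁ (subst (_∈ X) v≡ v∈X)) , (λ v≡ → inj₂ (subst (_∈ X) v≡ v∈X)) ]′ (orig-or-twin v))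

    touched⇒∉S : ∀ {x} → x ∈ touched → x ∉ S
    touched⇒∉S x∈ with ∈touched⇒copy∈X x∈
    ... | w , w∈X , refl = ∈A⇒vertex∉S (X⊆A w∈X)

    Touched : Fin n → Set
    Touched r = ∃ λ x → x ∈ touched × rep x ≡ r

    touched? : Decidable Touched
    touched? r = FinP.any? (λ x → x ∈? touched ×-dec rep x Fin.≟ r)

    S-boundary : Subset n
    S-boundary = select (λ s → s ∈? S ×-dec FinP.any? (λ x → x ∈? touched ×-dec adj G x s BoolP.≟ true))

    ∈S-boundary⁺ : ∀ {x s} → s ∈ S → x ∈ touched → adj G x s ≡ true → s ∈ S-boundary
    ∈S-boundary⁺ s∈S x∈ xs = ∈-select⁺
      (λ s → s ∈? S ×-dec FinP.any? (λ x → x ∈? touched ×-dec adj G x s BoolP.≟ true)) (s∈S , _ , x∈ , xs)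

    ∈S-boundary⁻ : ∀ {s} → s ∈ S-boundary → s ∈ S × ∃ λ x → x ∈ touched × adj G x s ≡ true
    ∈S-boundary⁻ = ∈-select⁻ (λ s → s ∈? S ×-dec FinP.any? (λ x → x ∈? touched ×-dec adj G x s BoolP.≟ true))

    touched-dummies : Subset n
    touched-dummies = select (λ u → dummy? u ×-dec touched? (rep u))

    missing : Fin n → ℕ
    missing r = ∣ left r ─ X ∣

    almost-covered : Subset n
    almost-covered = select (λ r → touched? r ×-dec missing r ℕ.≤? 1)

    orig[S-boundary]⊆N[X] : ∀ {s} → s ∈ S-boundary → orig s ∈ Neighbours E X
    orig[S-boundary]⊆N[X] s∈ with ∈S-boundary⁻ s∈
    ... | s∈S , x , x∈ , xs with ∈touched⇒copy∈X x∈
    ...   | w , w∈X , refl = ∈-Neighbours⁺ w∈X (orig∈E⁺ s∈S xs)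

    twin[touched-dummies]⊆N[X] : ∀ {u} → u ∈ touched-dummies → twin u ∈ Neighbours E X
    twin[touched-dummies]⊆N[X] u∈ with ∈-select⁻ (λ u → dummy? u ×-dec touched? (rep u)) u∈
    ... | dummy , x , x∈ , eq with ∈touched⁻ x∈
    ...   | inj₁ orig∈X = ∈-Neighbours⁺ orig∈X (twin∈E⁺ (∈dummies⁺ dummy (sym eq)))
    ...   | inj₂ twin∈X = ⊥-elim (dummy⇒¬Trivial dummy (touched⇒∉S x∈) (sym eq) (twin∈A⁻ (X⊆A twin∈X)))

    S-boundary++touched-dummies⊆N[X] : S-boundary ++ touched-dummies ⊆ Neighbours E X
    S-boundary++touched-dummies⊆N[X] {v} v∈ with copy v
    ... | orig-copy s = orig[S-boundary]⊆N[X] (∈-++⁻ˡ _ v∈)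
    ... | twin-copy u = twin[touched-dummies]⊆N[X] (∈-++⁻ʳ _ v∈)

    ∣S-boundary∣+∣touched-dummies∣≤∣N[X]∣ : ∣ S-boundary ∣ + ∣ touched-dummies ∣ ≤ ∣ Neighbours E X ∣
    ∣S-boundary∣+∣touched-dummies∣≤∣N[X]∣ = subst (_≤ ∣ Neighbours E X ∣) (∣p++q∣≡∣p∣+∣q∣ S-boundary touched-dummies)
      (p⊆q⇒∣p∣≤∣q∣ S-boundary++touched-dummies⊆N[X])

    touched-component : ∀ {x} → x ∈ touched →
      ∣ X ∩ fibre (rep ∘ vertex) (rep x) ∣ + missing (rep x) ≤ ∣ touched-dummies ∩ fibre rep (rep x) ∣ + 2
    touched-component {x} x∈ = begin
      ∣ X ∩ F ∣ + missing (rep x) ≤⟨ ℕP.+-monoˡ-≤ (missing (rep x)) (p⊆q⇒∣p∣≤∣q∣ X∩F⊆L∩X) ⟩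
      ∣ L ∩ X ∣ + ∣ L ─ X ∣       ≡⟨ ∣p∩q∣+∣p─q∣≡∣p∣ L X ⟩
      ∣ L ∣                       ≡⟨ ∣left∣≡∣dummies∣+2 (touched⇒∉S x∈) ⟩
      ∣ D ∣ + 2                   ≤⟨ ℕP.+-monoˡ-≤ 2 (p⊆q⇒∣p∣≤∣q∣ D⊆TD∩F′) ⟩
      ∣ TD ∩ F′ ∣ + 2             ∎
      where
      open ℕP.≤-Reasoning
      F L : Subset (n + n)
      F = fibre (rep ∘ vertex) (rep x)
      L = left (rep x)
      F′ D TD : Subset n
      F′ = fibre rep (rep x)
      D = dummies (rep x)
      TD = touched-dummies
      X∩F⊆L∩X : X ∩ F ⊆ L ∩ X
      X∩F⊆L∩X v∈ with x∈p∩q⁻ X F v∈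
      ... | v∈X , v∈F = x∈p∩q⁺ (∈left⁺ (X⊆A v∈X) (∈fibre⁻ {f = rep ∘ vertex} v∈F) , v∈X)
      D⊆TD∩F′ : D ⊆ TD ∩ F′
      D⊆TD∩F′ u∈ with ∈dummies⁻ u∈
      ... | dummy , eq = x∈p∩q⁺ (∈-select⁺ (λ u → dummy? u ×-dec touched? (rep u)) (dummy , x , x∈ , sym eq) ,
                                 ∈fibre⁺ {f = rep} eq)

    component-bound : ∀ r → ∣ X ∩ fibre (rep ∘ vertex) r ∣ ≤
                            ∣ touched-dummies ∩ fibre rep r ∣ + 2 * ∣ almost-covered ∩ fibre id r ∣
    component-bound r with touched? r
    ... | no untouched = ℕP.≤-trans (ℕP.≤-reflexive (Empty⇒∣p∣≡0 empty)) z≤n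
      where
      empty : Empty (X ∩ fibre (rep ∘ vertex) r)
      empty (v , v∈) with x∈p∩q⁻ X _ v∈
      ... | v∈X , v∈fibre = untouched (vertex v , vertex∈touched v∈X , ∈fibre⁻ {f = rep ∘ vertex} v∈fibre)
    ... | yes (x , x∈ , refl) with missing (rep x) ℕ.≤? 1
    ...   | yes ≤1 = ℕP.≤-trans (ℕP.m≤m+n _ (missing (rep x)))
                       (ℕP.≤-trans (touched-component x∈) (ℕP.+-monoʳ-≤ _ (ℕP.*-monoʳ-≤ 2 1≤∣AC∩F∣)))
      where
      1≤∣AC∩F∣ : 1 ≤ ∣ almost-covered ∩ fibre id (rep x) ∣
      1≤∣AC∩F∣ = ℕP.≤-trans (s≤s z≤n) (x∈p⇒∣p-x∣<∣p∣ (x∈p∩q⁺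
        (∈-select⁺ (λ r → touched? r ×-dec missing r ℕ.≤? 1) ((x , x∈ , refl) , ≤1) ,
         ∈fibre⁺ {f = id} refl)))
    ...   | no ≰1 = ℕP.≤-trans (ℕP.+-cancelʳ-≤ 2 _ _
                       (ℕP.≤-trans (ℕP.+-monoʳ-≤ _ (ℕP.≰⇒> ≰1)) (touched-component x∈))) (ℕP.m≤m+n _ _)

    ∣X∣≤∣touched-dummies∣+2∣almost-covered∣ : ∣ X ∣ ≤ ∣ touched-dummies ∣ + 2 * ∣ almost-covered ∣
    ∣X∣≤∣touched-dummies∣+2∣almost-covered∣ = begin
      ∣ X ∣                                  ≡⟨ ∣p∣≡∑∣p∩fibre∣ (rep ∘ vertex) X ⟩
      ∑[ r < n ] ∣ X ∩ fibre (rep ∘ vertex) r ∣ ≤⟨ ∑-mono-≤ component-bound ⟩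
      ∑[ r < n ] (dum r + 2 * cov r)          ≡⟨ ∑-distrib-+ dum (λ r → 2 * cov r) ⟩
      ∑[ r < n ] dum r + ∑[ r < n ] (2 * cov r) ≡⟨ cong₂ _+_ (sym (∣p∣≡∑∣p∩fibre∣ rep touched-dummies))
                                                     (trans (sym (*-distribˡ-sum 2 cov))
                                                       (cong (2 *_) (sym (∣p∣≡∑∣p∩fibre∣ id almost-covered)))) ⟩
      ∣ touched-dummies ∣ + 2 * ∣ almost-covered ∣ ∎
      where
      open ℕP.≤-Reasoning
      dum cov : Fin n → ℕ
      dum r = ∣ touched-dummies ∩ fibre rep r ∣
      cov r = ∣ almost-covered ∩ fibre id r ∣

    unreached : Subset n
    unreached = select (λ x → ¬? (x ∈? S) ×-dec ¬? (x ∈? touched) ×-dec rep x ∈? almost-covered)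

    ∈unreached⁻ : ∀ {x} → x ∈ unreached → x ∉ S × x ∉ touched × rep x ∈ almost-covered
    ∈unreached⁻ = ∈-select⁻ (λ x → ¬? (x ∈? S) ×-dec ¬? (x ∈? touched) ×-dec rep x ∈? almost-covered)

    ∈almost-covered⁻ : ∀ {r} → r ∈ almost-covered → Touched r × missing r ≤ 1
    ∈almost-covered⁻ = ∈-select⁻ (λ r → touched? r ×-dec missing r ℕ.≤? 1)

    -- Two unreached vertices of one component would both be missing from X.
    ∣unreached∣≤∣almost-covered∣ : ∣ unreached ∣ ≤ ∣ almost-covered ∣
    ∣unreached∣≤∣almost-covered∣ =
      injectiveOn⇒∣p∣≤∣q∣ rep (proj₂ ∘ proj₂ ∘ ∈unreached⁻) rep-injective
      where
      orig∈left─X : ∀ {x} → x ∈ unreached → orig x ∈ left (rep x) ─ X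
      orig∈left─X x∈ with ∈unreached⁻ x∈
      ... | x∉S , x∉touched , _ = x∈p∧x∉q⇒x∈p─q (∈left⁺ (orig∈A⁺ x∉S) (cong rep (vertex-orig _)))
              (λ orig∈X → x∉touched (subst (_∈ touched) (vertex-orig _) (vertex∈touched orig∈X)))
      rep-injective : InjectiveOn unreached rep
      rep-injective {x} {y} x∈ y∈ eq with x Fin.≟ y
      ... | yes x≡y = x≡y
      ... | no x≢y = ⊥-elim (ℕP.<⇒≱ (s≤s (proj₂ (∈almost-covered⁻ (proj₂ (proj₂ (∈unreached⁻ x∈))))))
              (two-members⇒2≤∣p∣ (orig∈left─X x∈) (subst (λ r → orig y ∈ left r ─ X) (sym eq) (orig∈left─X y∈))
                 (x≢y ∘ orig-injective)))

    separator : Subset n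
    separator = S-boundary ∪ unreached

    ∣separator∣≤ : ∣ separator ∣ ≤ ∣ S-boundary ∣ + ∣ almost-covered ∣
    ∣separator∣≤ = ℕP.≤-trans (∣p∪q∣≤∣p∣+∣q∣ S-boundary unreached) (ℕP.+-monoʳ-≤ _ ∣unreached∣≤∣almost-covered∣)

    touched∉separator : ∀ {x} → x ∈ touched → x ∉ separator
    touched∉separator x∈ x∈sep with x∈p∪q⁻ S-boundary unreached x∈sep
    ... | inj₁ x∈SB = touched⇒∉S x∈ (proj₁ (∈S-boundary⁻ x∈SB))
    ... | inj₂ x∈U = proj₁ (proj₂ (∈unreached⁻ x∈U)) x∈

    separator-confines : ∀ {a b} → Reach G separator a b → a ∉ S → rep a ∈ almost-covered →
                         b ∉ S × rep b ≡ rep a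
    separator-confines (here _) a∉S _ = a∉S , refl
    separator-confines (step {v = v} {w = b} a↝v vb b∉sep) a∉S rep-a∈ with separator-confines a↝v a∉S rep-a∈
    ... | v∉S , rep-v≡ = b∉S , trans (sym (Reach⇒rep≡ (step (here v∉S) vb b∉S))) rep-v≡
      where
      v∈touched : v ∈ touched
      v∈touched with v ∈? touched
      ... | yes v∈ = v∈
      ... | no v∉ = ⊥-elim (Components.Reach-target∉ G separator a↝v (x∈p∪q⁺ (inj₂
              (∈-select⁺ (λ x → ¬? (x ∈? S) ×-dec ¬? (x ∈? touched) ×-dec rep x ∈? almost-covered)
                (v∉S , v∉ , subst (_∈ almost-covered) (sym rep-v≡) rep-a∈)))))
      b∉S : b ∉ S
      b∉S b∈S = b∉sep (x∈p∪q⁺ (inj₁ (∈S-boundary⁺ b∈S v∈touched vb)))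

    module _ {t} (4≤t : ℕtoℚ 4 ℚ.≤ t) (tough : Tough t G) (cut : Cutset G S) where

      private
        witness : ∀ {r} → r ∈ almost-covered → ∃ λ x → x ∈ touched × rep x ≡ r
        witness = proj₁ ∘ ∈almost-covered⁻

        confined : ∀ {r x b} → r ∈ almost-covered → x ∈ touched → rep x ≡ r → Reach G separator x b → rep b ≡ r
        confined r∈ x∈ refl x↝b = proj₂ (separator-confines x↝b (touched⇒∉S x∈) r∈)

      many-almost-covered : 2 ≤ ∣ almost-covered ∣ → 2 * ∣ almost-covered ∣ ≤ ∣ S-boundary ∣
      many-almost-covered 2≤ = 4k≤a+k⇒2k≤a ∣ almost-covered ∣ ∣ S-boundary ∣
        (ℕP.≤-trans (scattered⇒4*≤∣T∣ 4≤t tough separator 2≤ (g∉separator , g-separated)) ∣separator∣≤)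
        where
        4k≤a+k⇒2k≤a : ∀ k a → 4 * k ≤ a + k → 2 * k ≤ a
        4k≤a+k⇒2k≤a k a 4k≤a+k = ℕP.≤-trans (ℕP.*-monoˡ-≤ k (ℕP.n≤1+n 2)) (ℕP.+-cancelʳ-≤ k (3 * k) a
          (subst (_≤ a + k) (trans (ℕP.*-distribʳ-+ k 3 1) (cong (3 * k +_) (ℕP.+-identityʳ k))) 4k≤a+k))
        chosen : ∀ i → ∃ λ x → x ∈ touched × rep x ≡ enumerate almost-covered i
        chosen i = witness (enumerate∈ almost-covered i)
        g : Fin ∣ almost-covered ∣ → Fin n
        g i = proj₁ (chosen i)
        g∉separator : ∀ i → g i ∉ separator
        g∉separator i = touched∉separator (proj₁ (proj₂ (chosen i)))
        g-separated : ∀ i j → Reach G separator (g i) (g j) → i ≡ j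
        g-separated i j gi↝gj = enumerate-injective almost-covered (trans (sym rep-gj≡) (proj₂ (proj₂ (chosen j))))
          where
          rep-gj≡ : rep (g j) ≡ enumerate almost-covered i
          rep-gj≡ = confined (enumerate∈ almost-covered i) (proj₁ (proj₂ (chosen i))) (proj₂ (proj₂ (chosen i))) gi↝gj

      -- The cutset S provides a component besides the only almost-covered one.
      one-almost-covered : ∀ {r₀} → r₀ ∈ almost-covered → ∣ almost-covered ∣ ≤ 1 → 2 ≤ ∣ S-boundary ∣
      one-almost-covered {r₀} r₀∈ ∣AC∣≤1 = ℕP.+-cancelʳ-≤ 1 2 ∣ S-boundary ∣ (ℕP.≤-trans (ℕP.m≤m+n 3 5)
        (ℕP.≤-trans (scattered⇒4*≤∣T∣ 4≤t tough separator ℕP.≤-refl (g∉separator , g-separated))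
          (ℕP.≤-trans ∣separator∣≤ (ℕP.+-monoʳ-≤ _ ∣AC∣≤1))))
        where
        w₀ : Fin n
        w₀ = proj₁ (witness r₀∈)
        w₀∈ : w₀ ∈ touched
        w₀∈ = proj₁ (proj₂ (witness r₀∈))
        other-component : ∃ λ z → z ∉ S × rep z ≢ r₀
        other-component = pick cut
          where
          pick : Cutset G S → ∃ λ z → z ∉ S × rep z ≢ r₀
          pick (u , v , u∉S , v∉S , u↝̸v) with rep u Fin.≟ r₀ | rep v Fin.≟ r₀
          ... | no rep-u≢ | _ = u , u∉S , rep-u≢
          ... | yes _ | no rep-v≢ = v , v∉S , rep-v≢
          ... | yes rep-u≡ | yes rep-v≡ = ⊥-elim (u↝̸v (rep≡⇒Reach u∉S v∉S (trans rep-u≡ (sym rep-v≡))))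
        z : Fin n
        z = proj₁ other-component
        z∉separator : z ∉ separator
        z∉separator z∈ with x∈p∪q⁻ S-boundary unreached z∈
        ... | inj₁ z∈SB = proj₁ (proj₂ other-component) (proj₁ (∈S-boundary⁻ z∈SB))
        ... | inj₂ z∈U = proj₂ (proj₂ other-component) (∣p∣≤1⇒x≡y ∣AC∣≤1 (proj₂ (proj₂ (∈unreached⁻ z∈U))) r₀∈)
        w₀↝̸z : ¬ Reach G separator w₀ z
        w₀↝̸z w₀↝z = proj₂ (proj₂ other-component) (confined r₀∈ w₀∈ (proj₂ (proj₂ (witness r₀∈))) w₀↝z)
        g : Fin 2 → Fin n
        g zero = w₀
        g (suc zero) = z
        g∉separator : ∀ i → g i ∉ separator
        g∉separator zero = touched∉separator w₀∈
        g∉separator (suc zero) = z∉separator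
        g-separated : ∀ i j → Reach G separator (g i) (g j) → i ≡ j
        g-separated zero zero _ = refl
        g-separated zero (suc zero) w₀↝z = ⊥-elim (w₀↝̸z w₀↝z)
        g-separated (suc zero) zero z↝w₀ = ⊥-elim (w₀↝̸z (Components.Reach-sym G separator z↝w₀))
        g-separated (suc zero) (suc zero) _ = refl

      2∣almost-covered∣≤∣S-boundary∣ : 2 * ∣ almost-covered ∣ ≤ ∣ S-boundary ∣
      2∣almost-covered∣≤∣S-boundary∣ with ∣ almost-covered ∣ ℕ.≤? 1
      ... | no ≰1 = many-almost-covered (ℕP.≰⇒> ≰1)
      ... | yes ≤1 with nonempty? almost-covered
      ...   | yes (r₀ , r₀∈) = ℕP.≤-trans (ℕP.*-monoʳ-≤ 2 ≤1) (one-almost-covered r₀∈ ≤1)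
      ...   | no empty = subst (λ k → 2 * k ≤ ∣ S-boundary ∣) (sym (Empty⇒∣p∣≡0 empty)) z≤n

      hall-condition : ∣ X ∣ ≤ ∣ Neighbours E X ∣
      hall-condition = begin
        ∣ X ∣                                       ≤⟨ ∣X∣≤∣touched-dummies∣+2∣almost-covered∣ ⟩
        ∣ touched-dummies ∣ + 2 * ∣ almost-covered ∣ ≤⟨ ℕP.+-monoʳ-≤ ∣ touched-dummies ∣ 2∣almost-covered∣≤∣S-boundary∣ ⟩
        ∣ touched-dummies ∣ + ∣ S-boundary ∣         ≡⟨ ℕP.+-comm ∣ touched-dummies ∣ ∣ S-boundary ∣ ⟩
        ∣ S-boundary ∣ + ∣ touched-dummies ∣         ≤⟨ ∣S-boundary∣+∣touched-dummies∣≤∣N[X]∣ ⟩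
        ∣ Neighbours E X ∣                          ∎
        where open ℕP.≤-Reasoning

  -- Reading off the generalized K_{1,2}-matching

  module _ (M : Matching E A) where

    private
      f : Fin (n + n) → Fin (n + n)
      f = proj₁ M
      f∈E : ∀ {v} → v ∈ A → f v ∈ E v
      f∈E = proj₁ (proj₂ M)
      f-injective : InjectiveOn A f
      f-injective = proj₂ (proj₂ M)

    matched-into-S : Subset (n + n)
    matched-into-S = select (isOrig? ∘ f)

    ∈matched-into-S⁻ : ∀ {v} → v ∈ A → v ∈ matched-into-S →
                       f v ≡ orig (vertex (f v)) × vertex (f v) ∈ S × adj G (vertex v) (vertex (f v)) ≡ true
    ∈matched-into-S⁻ {v} v∈A v∈ with ∈-select⁻ (isOrig? ∘ f) v∈
    ... | s , fv≡orig rewrite fv≡orig | vertex-orig s = refl , orig∈E⁻ (subst (_∈ E v) fv≡orig (f∈E v∈A))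

    ∣left─matched-into-S∣≤∣dummies∣ : ∀ {x} → x ∉ S → ∣ left (rep x) ─ matched-into-S ∣ ≤ ∣ dummies (rep x) ∣
    ∣left─matched-into-S∣≤∣dummies∣ {x} x∉S = injectiveOn⇒∣p∣≤∣q∣ (vertex ∘ f) into-dummies injective
      where
      twin-image : ∀ {v} → v ∈ left (rep x) ─ matched-into-S → ∃ λ u → f v ≡ twin u
      twin-image v∈ = ¬IsOrig⇒twin (proj₂ (x∈p─q⁻ _ _ v∈) ∘ ∈-select⁺ (isOrig? ∘ f))
      into-dummies : ∀ {v} → v ∈ left (rep x) ─ matched-into-S → vertex (f v) ∈ dummies (rep x)
      into-dummies {v} v∈ with twin-image v∈ | ∈left⁻ (proj₁ (x∈p─q⁻ _ _ v∈))
      ... | u , fv≡twin | v∈A , rep-v≡ with twin∈E⁻ (subst (_∈ E v) fv≡twin (f∈E v∈A))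
      ...   | y , refl , u∈ rewrite fv≡twin | vertex-twin u | vertex-orig y = subst (λ r → u ∈ dummies r) rep-v≡ u∈
      injective : InjectiveOn (left (rep x) ─ matched-into-S) (vertex ∘ f)
      injective {v} {w} v∈ w∈ eq with twin-image v∈ | twin-image w∈
      ... | _ , fv≡twin | _ , fw≡twin = f-injective (∈A v∈) (∈A w∈)
            (trans (≡twin⇒≡twin∘vertex fv≡twin) (trans (cong twin eq) (sym (≡twin⇒≡twin∘vertex fw≡twin))))
        where
        ∈A : ∀ {v} → v ∈ left (rep x) ─ matched-into-S → v ∈ A
        ∈A = proj₁ ∘ ∈left⁻ ∘ proj₁ ∘ x∈p─q⁻ _ _

    2≤∣left∩matched-into-S∣ : ∀ {x} → x ∉ S → 2 ≤ ∣ left (rep x) ∩ matched-into-S ∣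
    2≤∣left∩matched-into-S∣ {x} x∉S = ℕP.+-cancelʳ-≤ ∣ L ─ matched-into-S ∣ 2 _ (begin
      2 + ∣ L ─ matched-into-S ∣                          ≤⟨ ℕP.+-monoʳ-≤ 2 (∣left─matched-into-S∣≤∣dummies∣ x∉S) ⟩
      2 + ∣ dummies (rep x) ∣                             ≡⟨ ℕP.+-comm 2 _ ⟩
      ∣ dummies (rep x) ∣ + 2                             ≡⟨ sym (∣left∣≡∣dummies∣+2 x∉S) ⟩
      ∣ L ∣                                               ≡⟨ sym (∣p∩q∣+∣p─q∣≡∣p∣ L matched-into-S) ⟩
      ∣ L ∩ matched-into-S ∣ + ∣ L ─ matched-into-S ∣      ∎)
      where
      open ℕP.≤-Reasoning
      L : Subset (n + n)
      L = left (rep x)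

    private
      MatchedEdge : Subset n → Fin (n + n) → Set
      MatchedEdge C v = v ∈ A × vertex v ∈ C × f v ≡ orig (vertex (f v)) ×
                        vertex (f v) ∈ S × adj G (vertex v) (vertex (f v)) ≡ true

      Attachment : Subset n → Subset n → Set
      Attachment C σ = σ ⊆ Nbr G C ∩ S × GenK12 G C σ ×
                       (∀ {s} → s ∈ σ → ∃ λ v → v ∈ A × vertex v ∈ C × f v ≡ orig s)

    attachment-of-edges : ∀ {C v₁ v₂} → (∀ x → x ∈ C → x ∉ S) → v₁ ≢ v₂ →
                          MatchedEdge C v₁ → MatchedEdge C v₂ → (2 ≤ ∣ C ∣ → vertex v₁ ≢ vertex v₂) →
                          Σ (Subset n) (Attachment C)
    attachment-of-edges {C} {v₁} {v₂} C∩S≡∅ v₁≢v₂ (v₁∈A , x₁∈C , fv₁≡ , s₁∈S , x₁s₁)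
                        (v₂∈A , x₂∈C , fv₂≡ , s₂∈S , x₂s₂) x₁≢x₂ =
      ⁅ s₁ ⁆ ∪ ⁅ s₂ ⁆ , (λ {s} → ⊆Nbr∩S {s}) , genK12 , origin
      where
      s₁ s₂ : Fin n
      s₁ = vertex (f v₁)
      s₂ = vertex (f v₂)
      s₁≢s₂ : s₁ ≢ s₂
      s₁≢s₂ eq = v₁≢v₂ (f-injective v₁∈A v₂∈A (trans fv₁≡ (trans (cong orig eq) (sym fv₂≡))))
      genK12 : GenK12 G C (⁅ s₁ ⁆ ∪ ⁅ s₂ ⁆)
      genK12 = pair-isGenK12 G x₁∈C x₂∈C (λ s₁∈C → C∩S≡∅ s₁ s₁∈C s₁∈S) (λ s₂∈C → C∩S≡∅ s₂ s₂∈C s₂∈S)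
                             x₁s₁ x₂s₂ s₁≢s₂ x₁≢x₂
      ⊆Nbr∩S : ⁅ s₁ ⁆ ∪ ⁅ s₂ ⁆ ⊆ Nbr G C ∩ S
      ⊆Nbr∩S s∈ with x∈p∪q⁻ ⁅ s₁ ⁆ ⁅ s₂ ⁆ s∈
      ... | inj₁ s∈⁅s₁⁆ rewrite x∈⁅y⁆⇒x≡y s₁ s∈⁅s₁⁆ = x∈p∩q⁺ (proj₁ (proj₂ genK12) s∈ , s₁∈S)
      ... | inj₂ s∈⁅s₂⁆ rewrite x∈⁅y⁆⇒x≡y s₂ s∈⁅s₂⁆ = x∈p∩q⁺ (proj₁ (proj₂ genK12) s∈ , s₂∈S)
      origin : ∀ {s} → s ∈ ⁅ s₁ ⁆ ∪ ⁅ s₂ ⁆ → ∃ λ v → v ∈ A × vertex v ∈ C × f v ≡ orig s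
      origin s∈ with x∈p∪q⁻ ⁅ s₁ ⁆ ⁅ s₂ ⁆ s∈
      ... | inj₁ s∈⁅s₁⁆ rewrite x∈⁅y⁆⇒x≡y s₁ s∈⁅s₁⁆ = v₁ , v₁∈A , x₁∈C , fv₁≡
      ... | inj₂ s∈⁅s₂⁆ rewrite x∈⁅y⁆⇒x≡y s₂ s∈⁅s₂⁆ = v₂ , v₂∈A , x₂∈C , fv₂≡

    opaque
      attachment : ∀ C → Component G S C → Σ (Subset n) (Attachment C)
      attachment C isC@((x , x∈C) , C∩S≡∅ , _)
        with 2≤∣p∣⇒two-members _ (2≤∣left∩matched-into-S∣ (C∩S≡∅ x x∈C))
      ... | v₁ , v₂ , v₁∈ , v₂∈ , v₁≢v₂ =
        attachment-of-edges C∩S≡∅ v₁≢v₂ (matched-edge v₁∈) (matched-edge v₂∈) x₁≢x₂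
        where
        x∉S : x ∉ S
        x∉S = C∩S≡∅ x x∈C
        C≡ : C ≡ component x
        C≡ = Component⇒≡component isC x∈C
        matched-edge : ∀ {v} → v ∈ left (rep x) ∩ matched-into-S → MatchedEdge C v
        matched-edge {v} v∈ with x∈p∩q⁻ (left (rep x)) matched-into-S v∈
        ... | v∈L , v∈M = v∈A , subst (vertex v ∈_) (sym C≡) (∈left⇒∈component x∉S v∈L) , ∈matched-into-S⁻ v∈A v∈M
          where
          v∈A : v ∈ A
          v∈A = proj₁ (∈left⁻ v∈L)
        x₁≢x₂ : 2 ≤ ∣ C ∣ → vertex v₁ ≢ vertex v₂
        x₁≢x₂ nontrivial = v₁≢v₂ ∘ left-vertex-injective x∉S (subst (λ C → 2 ≤ ∣ C ∣) C≡ nontrivial)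
                                     (proj₁ (x∈p∩q⁻ _ _ v₁∈)) (proj₁ (x∈p∩q⁻ _ _ v₂∈))

    genK12Matching : GenK12Matching G S
    genK12Matching = (λ C isC → proj₁ (attachment C isC)) ,
                     (λ C isC → proj₁ (proj₂ (attachment C isC)) , proj₁ (proj₂ (proj₂ (attachment C isC)))) ,
                     disjoint
      where
      disjoint : ∀ C C′ (isC : Component G S C) (isC′ : Component G S C′) → C ≢ C′ →
                 proj₁ (attachment C isC) ∩ proj₁ (attachment C′ isC′) ≡ ⊥
      disjoint C C′ isC isC′ C≢C′ = Empty-unique λ (s , s∈) →
        let s∈σ , s∈σ′ = x∈p∩q⁻ _ _ s∈
            v , v∈A , v∈C , fv≡ = proj₂ (proj₂ (proj₂ (attachment C isC))) s∈σ
            w , w∈A , w∈C′ , fw≡ = proj₂ (proj₂ (proj₂ (attachment C′ isC′))) s∈σ′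
            v≡w = f-injective v∈A w∈A (trans fv≡ (sym fw≡))
        in C≢C′ (trans (Component⇒≡component isC v∈C)
                      (sym (Component⇒≡component isC′ (subst (λ u → vertex u ∈ C′) (sym v≡w) w∈C′))))

open import Data.Integer using (+_)
open import Data.Rational using (_/_)

corollary2p4 : (t : ℚ) → (+ 4) / 1 ℚ.≤ t → ∀ {n} (G : Graph n) →
    Tough t G → P3∪3P1-free G →
    (S : Subset n) → Cutset G S → GenK12Matching G S
corollary2p4 t 4≤t G tough _ S cut@(u , _) =
  genK12Matching (hall ∣ A ∣ ℕP.≤-refl (orig u) λ X X⊆A → hall-condition X X⊆A 4≤t tough cut)
  where open Auxiliary G S
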